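{- For a positive integer $a_3$, the triple $(3,6,a_3)$ is perfect if and only if $a_3\geq2$.
   Context: For a graph $G$, the $3$-neighbour bootstrap process starts from a set $A_0\subseteq V(G)$ and, for $t\ge1$, sets $A_t=A_{t-1}\cup\{v: |N_G(v)\cap A_{t-1}|\ge 3\}$; $A_0$ percolates if $\bigcup_t A_t=V(G)$. For positive integers $a_1,a_2,a_3$, $[a_1]\times[a_2]\times[a_3]$ denotes the grid graph (vertices adjacent iff they differ by exactly 1 in exactly one coordinate), and $m(a_1,a_2,a_3;3)$ is the minimum size of a percolating set for the $3$-neighbour process in it. A triple $(a_1,a_2,a_3)$ of positive integers is called perfect if $a_1a_2+a_1a_3+a_2a_3\equiv 0\pmod 3$ and $m(a_1,a_2,a_3;3)=\frac{a_1a_2+a_1a_3+a_2a_3}{3}$. -}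

module Defs where

open import Data.Nat using (ℕ; zero; suc; _+_; _*_; _≤_; _/_; _≡ᵇ_; _≤ᵇ_)
open import Data.Nat.Divisibility using (_∣_)
open import Data.Fin using (Fin; toℕ)
open import Data.Bool using (Bool; true; false; _∧_; _∨_; T)
open import Data.List using (List; []; _∷_; allFin; map; concatMap)
open import Data.Product using (_×_; _,_; Σ; ∃)

Vertex : ℕ → ℕ → ℕ → Set
Vertex a₁ a₂ a₃ = Fin a₁ × Fin a₂ × Fin a₃

vertices : (a₁ a₂ a₃ : ℕ) → List (Vertex a₁ a₂ a₃)
vertices a₁ a₂ a₃ =
  concatMap (λ i → concatMap (λ j → map (λ k → (i , j , k)) (allFin a₃)) (allFin a₂)) (allFin a₁)

countB : ∀ {A : Set} → (A → Bool) → List A → ℕ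
countB p [] = 0
countB p (x ∷ xs) with p x
... | true  = suc (countB p xs)
... | false = countB p xs

dist1 : ℕ → ℕ → Bool
dist1 x y = (suc x ≡ᵇ y) ∨ (suc y ≡ᵇ x)

adj : ∀ {a₁ a₂ a₃} → Vertex a₁ a₂ a₃ → Vertex a₁ a₂ a₃ → Bool
adj (x₁ , x₂ , x₃) (y₁ , y₂ , y₃) =
     (dist1 (toℕ x₁) (toℕ y₁) ∧ (toℕ x₂ ≡ᵇ toℕ y₂) ∧ (toℕ x₃ ≡ᵇ toℕ y₃))
  ∨ ((toℕ x₁ ≡ᵇ toℕ y₁) ∧ dist1 (toℕ x₂) (toℕ y₂) ∧ (toℕ x₃ ≡ᵇ toℕ y₃))
  ∨ ((toℕ x₁ ≡ᵇ toℕ y₁) ∧ (toℕ x₂ ≡ᵇ toℕ y₂) ∧ dist1 (toℕ x₃) (toℕ y₃))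

VSet : ℕ → ℕ → ℕ → Set
VSet a₁ a₂ a₃ = Vertex a₁ a₂ a₃ → Bool

size : ∀ {a₁ a₂ a₃} → VSet a₁ a₂ a₃ → ℕ
size {a₁} {a₂} {a₃} A = countB A (vertices a₁ a₂ a₃)

nbrsIn : ∀ {a₁ a₂ a₃} → VSet a₁ a₂ a₃ → Vertex a₁ a₂ a₃ → ℕ
nbrsIn {a₁} {a₂} {a₃} A v = countB (λ w → adj v w ∧ A w) (vertices a₁ a₂ a₃)

step : ∀ {a₁ a₂ a₃} → VSet a₁ a₂ a₃ → VSet a₁ a₂ a₃
step A v = A v ∨ (3 ≤ᵇ nbrsIn A v)

stage : ∀ {a₁ a₂ a₃} → ℕ → VSet a₁ a₂ a₃ → VSet a₁ a₂ a₃
stage zero    A = A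
stage (suc t) A = step (stage t A)

Percolates : ∀ {a₁ a₂ a₃} → VSet a₁ a₂ a₃ → Set
Percolates {a₁} {a₂} {a₃} A = (v : Vertex a₁ a₂ a₃) → ∃ λ t → T (stage t A v)

IsMinPercolatingSize : (a₁ a₂ a₃ k : ℕ) → Set
IsMinPercolatingSize a₁ a₂ a₃ k =
  (Σ (VSet a₁ a₂ a₃) λ A → Percolates A × size A ≡ k)
  × ((A : VSet a₁ a₂ a₃) → Percolates A → k ≤ size A)
  where open import Relation.Binary.PropositionalEquality using (_≡_)

Perfect : ℕ → ℕ → ℕ → Set
Perfect a₁ a₂ a₃ =
  (3 ∣ (a₁ * a₂ + a₁ * a₃ + a₂ * a₃))
  × IsMinPercolatingSize a₁ a₂ a₃ ((a₁ * a₂ + a₁ * a₃ + a₂ * a₃) / 3)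

-- For a vertex set B let degreeSum B = Σ_{v ∈ B} |N(v) ∩ B|; then
-- 6 |B| - degreeSum B is the surface area of the union of the unit cubes of B.  Infecting
-- a vertex with k ≥ 3 infected neighbours changes it by 6 - 2k ≤ 0, and for the whole grid
-- it is 2 (a₁a₂ + a₁a₃ + a₂a₃) = 2S.  Hence every percolating set A has
-- 2S + degreeSum A ≤ 6 |A|, so |A| ≥ S / 3.
--
-- n = 1.  In [3] × [6] × [1] a corner has two neighbours, and two adjacent border vertices
-- with three neighbours each cannot both stay healthy, so walking along a long side one
-- finds two adjacent vertices of A.  Then degreeSum A ≥ 1 and |A| > 9 = S / 3.
--
-- n ≥ 2.  Seed three cells on every layer, with a pattern depending on the parity of the
-- layer, and a few extra cells at the bottom and near the top: 3n + 6 = S / 3 cells.  The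
-- infection first sweeps upwards, filling 13 of the 18 cells of each layer, fills the top
-- layers, and then sweeps back down filling the rest.  Each step of the sweeps involves
-- only two or three consecutive layers; it is certified by evaluating the bootstrap process
-- on that window of [3] × [6] × [n].

module Submission where

open import Defs
open import Data.Nat using (ℕ; _≤_)
open import Function.Bundles using (_⇔_)

open import Data.Bool using (Bool; true; false; _∧_; _∨_; not; T)
open import Data.Bool.ListAction using (any)
open import Data.Bool.Properties using (T-∧; T-∨; T-≡; T?; ∧-identityʳ; ∨-comm)
open import Data.Empty using (⊥-elim)
open import Data.Fin as Fin using (Fin; toℕ; fromℕ<; #_)
open import Data.Fin.Properties
  using (toℕ<n; toℕ-fromℕ<; fromℕ<-toℕ; fromℕ<-cong; fromℕ<-injective; toℕ-injective; all?)
open import Data.List using (List; []; _∷_; _++_; map; concatMap; tabulate; allFin; filterᵇ)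
open import Data.List.Membership.Propositional using (_∈_)
open import Data.List.Membership.Propositional.Properties using (∈-allFin; ∈-concatMap⁺; ∈-map⁺)
open import Data.List.Relation.Unary.All using (All; _∷_)
open import Data.List.Relation.Unary.All.Properties using (all-filter)
open import Data.List.Relation.Unary.Any as Any using (here; there)
open import Data.Nat
  using (NonZero; zero; suc; _+_; _*_; _∸_; _<_; _≤′_; ≤′-refl; ≤′-step; z≤n; s≤s; s≤s⁻¹; _≡ᵇ_; _<ᵇ_; _≤ᵇ_; _⊔_; _/_)
open import Data.Nat.Divisibility using (_∣_; divides)
open import Data.Nat.DivMod using (m*n/n≡m)
open import Data.Nat.Properties
open import Data.Nat.Tactic.RingSolver using (solve-∀)
open import Data.Product using (_×_; _,_; ∃; proj₁; proj₂)
open import Data.Product.Properties using (≡-dec)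
open import Data.Sum using (_⊎_; inj₁; inj₂)
open import Data.Unit using (tt)
open import Data.Vec as Vec using (Vec; _∷_; [])
open import Data.Vec.Properties using (lookup∘tabulate)
open import Function using (_∘_; id)
open import Function.Bundles using (Equivalence; mk⇔)
open import Relation.Binary.Definitions using (DecidableEquality)
open import Relation.Binary.PropositionalEquality
open import Relation.Nullary using (¬_; Dec; yes; no; does)
open import Relation.Nullary.Decidable using (True; toWitness; _→-dec_)

open import Algebra.Properties.Semiring.Sum +-*-semiring
  using (sum-syntax; sum-cong-≗; ∑-distrib-+; ∑-comm; *-distribˡ-sum; *-distribʳ-sum)
open Equivalence using (to; from)

⟦_⟧ : Bool → ℕ
⟦ true ⟧  = 1
⟦ false ⟧ = 0

⟦⟧-mono : ∀ {a b} → (T a → T b) → ⟦ a ⟧ ≤ ⟦ b ⟧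
⟦⟧-mono {false}         _   = z≤n
⟦⟧-mono {true} {true}   _   = ≤-refl
⟦⟧-mono {true} {false} a⇒b = ⊥-elim (a⇒b tt)

⟦⟧-∧ : ∀ a b → ⟦ a ∧ b ⟧ ≡ ⟦ a ⟧ * ⟦ b ⟧
⟦⟧-∧ false b = refl
⟦⟧-∧ true  b = sym (+-identityʳ ⟦ b ⟧)

⟦⟧-∨ : ∀ a b → ⟦ a ∨ b ⟧ ≡ ⟦ a ⟧ + ⟦ not a ∧ b ⟧
⟦⟧-∨ false b = refl
⟦⟧-∨ true  b = refl

T-∨ˡ : ∀ {a b} → T a → T (a ∨ b)
T-∨ˡ = from T-∨ ∘ inj₁

T-∨ʳ : ∀ a {b} → T b → T (a ∨ b)
T-∨ʳ a = from (T-∨ {a}) ∘ inj₂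

⟦⟧-∨≤ : ∀ a b → ⟦ a ∨ b ⟧ ≤ ⟦ a ⟧ + ⟦ b ⟧
⟦⟧-∨≤ false b = ≤-refl
⟦⟧-∨≤ true  b = s≤s z≤n

⟦⟧-∧∨ : ∀ a b c → ⟦ a ∧ (b ∨ c) ⟧ ≡ ⟦ a ∧ b ⟧ + ⟦ a ∧ (not b ∧ c) ⟧
⟦⟧-∧∨ false b c = refl
⟦⟧-∧∨ true  b c = ⟦⟧-∨ b c

⟦⟧-swap : ∀ a b c → ⟦ a ⟧ * ⟦ b ∧ c ⟧ ≡ ⟦ c ⟧ * ⟦ b ∧ a ⟧
⟦⟧-swap false false false = refl
⟦⟧-swap false false true  = refl
⟦⟧-swap false true  false = refl
⟦⟧-swap false true  true  = refl
⟦⟧-swap true  false false = refl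
⟦⟧-swap true  false true  = refl
⟦⟧-swap true  true  false = refl
⟦⟧-swap true  true  true  = refl

⟦⟧≤1 : ∀ b → ⟦ b ⟧ ≤ 1
⟦⟧≤1 false = z≤n
⟦⟧≤1 true  = ≤-refl

T⇒⟦⟧≡1 : ∀ {b} → T b → ⟦ b ⟧ ≡ 1
T⇒⟦⟧≡1 {true} _ = refl

⟦<ᵇ⟧+⟦≡ᵇ⟧≤1 : ∀ a b → ⟦ a <ᵇ b ⟧ + ⟦ a ≡ᵇ b ⟧ ≤ 1
⟦<ᵇ⟧+⟦≡ᵇ⟧≤1 zero    zero    = ≤-refl
⟦<ᵇ⟧+⟦≡ᵇ⟧≤1 zero    (suc b) = ≤-refl
⟦<ᵇ⟧+⟦≡ᵇ⟧≤1 (suc a) zero    = z≤n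
⟦<ᵇ⟧+⟦≡ᵇ⟧≤1 (suc a) (suc b) = ⟦<ᵇ⟧+⟦≡ᵇ⟧≤1 a b

⟦0<ᵇ⟧+⟦≡ᵇ0⟧≤1 : ∀ x → ⟦ 0 <ᵇ x ⟧ + ⟦ x ≡ᵇ 0 ⟧ ≤ 1
⟦0<ᵇ⟧+⟦≡ᵇ0⟧≤1 zero    = ≤-refl
⟦0<ᵇ⟧+⟦≡ᵇ0⟧≤1 (suc x) = ≤-refl

≡ᵇ-sym : ∀ x y → (x ≡ᵇ y) ≡ (y ≡ᵇ x)
≡ᵇ-sym zero    zero    = refl
≡ᵇ-sym zero    (suc y) = refl
≡ᵇ-sym (suc x) zero    = refl
≡ᵇ-sym (suc x) (suc y) = ≡ᵇ-sym x y

dist1-sym : ∀ x y → dist1 x y ≡ dist1 y x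
dist1-sym x y = ∨-comm (suc x ≡ᵇ y) (suc y ≡ᵇ x)

≢⇒not-≡ᵇ : ∀ {x y} → x ≢ y → T (not (x ≡ᵇ y))
≢⇒not-≡ᵇ {x} {y} x≢y with x ≡ᵇ y in eq
... | true  = x≢y (≡ᵇ⇒≡ x y (subst T (sym eq) tt))
... | false = tt

≡ᵇ-+ʳ : ∀ b x y → (x + b ≡ᵇ y + b) ≡ (x ≡ᵇ y)
≡ᵇ-+ʳ b x y rewrite +-comm x b | +-comm y b = go b
  where
  go : ∀ b → (b + x ≡ᵇ b + y) ≡ (x ≡ᵇ y)
  go zero    = refl
  go (suc b) = go b

dist1-+ʳ : ∀ b x y → dist1 (x + b) (y + b) ≡ dist1 x y
dist1-+ʳ b x y rewrite +-comm x b | +-comm y b = go b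
  where
  go : ∀ b → dist1 (b + x) (b + y) ≡ dist1 x y
  go zero    = refl
  go (suc b) = go b

countB-∷ : ∀ {A : Set} (p : A → Bool) x xs → countB p (x ∷ xs) ≡ ⟦ p x ⟧ + countB p xs
countB-∷ p x xs with p x
... | true  = refl
... | false = refl

countB-++ : ∀ {A : Set} (p : A → Bool) xs ys → countB p (xs ++ ys) ≡ countB p xs + countB p ys
countB-++ p []       ys = refl
countB-++ p (x ∷ xs) ys
  rewrite countB-∷ p x (xs ++ ys) | countB-∷ p x xs | countB-++ p xs ys = sym (+-assoc ⟦ p x ⟧ _ _)

module _ {A : Set} {p q : A → Bool} (p⇒q : ∀ x → T (p x) → T (q x)) where

  countB-mono : ∀ xs → countB p xs ≤ countB q xs
  countB-mono []       = z≤n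
  countB-mono (x ∷ xs) rewrite countB-∷ p x xs | countB-∷ q x xs =
    +-mono-≤ (⟦⟧-mono (p⇒q x)) (countB-mono xs)

  countB-mono-< : ∀ {x xs} → x ∈ xs → T (q x) → ¬ T (p x) → suc (countB p xs) ≤ countB q xs
  countB-mono-< {x} {xs = x ∷ xs} (here refl) qx ¬px
    rewrite countB-∷ p x xs | countB-∷ q x xs with p x | q x
  ... | true  | _     = ⊥-elim (¬px tt)
  ... | false | false = ⊥-elim qx
  ... | false | true  = s≤s (countB-mono xs)
  countB-mono-< {xs = y ∷ xs} (there x∈xs) qx ¬px
    rewrite countB-∷ p y xs | countB-∷ q y xs =
    subst (_≤ ⟦ q y ⟧ + countB q xs) (+-suc ⟦ p y ⟧ (countB p xs))
      (+-mono-≤ (⟦⟧-mono (p⇒q y)) (countB-mono-< x∈xs qx ¬px))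

module _ {A : Set} (_≟_ : DecidableEquality A) where

  _≢ᵇ_ : A → A → Bool
  w ≢ᵇ u = not (does (w ≟ u))

  ≢⇒≢ᵇ : ∀ {w u} → w ≢ u → T (w ≢ᵇ u)
  ≢⇒≢ᵇ {w} {u} w≢u with w ≟ u
  ... | yes w≡u = w≢u w≡u
  ... | no  _   = tt

  ≢ᵇ-irrefl : ∀ u → ¬ T (u ≢ᵇ u)
  ≢ᵇ-irrefl u with u ≟ u
  ... | yes _   = id
  ... | no  u≢u = ⊥-elim (u≢u refl)

  ≢ᵇ⇒≢ : ∀ {w u} → T (w ≢ᵇ u) → w ≢ u
  ≢ᵇ⇒≢ {u = u} w≢ᵇu refl = ≢ᵇ-irrefl u w≢ᵇu

  countB-remove : ∀ (p : A → Bool) {x xs} → x ∈ xs → T (p x) →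
                  suc (countB (λ w → p w ∧ w ≢ᵇ x) xs) ≤ countB p xs
  countB-remove p {x} x∈xs px =
    countB-mono-< (λ w → proj₁ ∘ to T-∧) x∈xs px (≢ᵇ-irrefl x ∘ proj₂ ∘ to T-∧)

  three≤countB : ∀ (p : A → Bool) {x y z} xs → x ∈ xs → y ∈ xs → z ∈ xs →
                 x ≢ y → x ≢ z → y ≢ z → T (p x) → T (p y) → T (p z) → 3 ≤ countB p xs
  three≤countB p {x} {y} {z} xs x∈ y∈ z∈ x≢y x≢z y≢z px py pz =
    ≤-trans (s≤s (≤-trans (s≤s (≤-trans (s≤s z≤n) remove-z)) remove-y)) remove-x
    where
    p₁ p₂ : A → Bool
    p₁ w = p w ∧ w ≢ᵇ x
    p₂ w = p₁ w ∧ w ≢ᵇ y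
    remove-x = countB-remove p x∈ px
    remove-y = countB-remove p₁ y∈ (from T-∧ (py , ≢⇒≢ᵇ (x≢y ∘ sym)))
    remove-z = countB-remove p₂ z∈ (from T-∧ (from T-∧ (pz , ≢⇒≢ᵇ (x≢z ∘ sym)) , ≢⇒≢ᵇ (y≢z ∘ sym)))

∑-mono : ∀ {m} {f g : Fin m → ℕ} → (∀ i → f i ≤ g i) → ∑[ i < m ] f i ≤ ∑[ i < m ] g i
∑-mono {zero}  f≤g = z≤n
∑-mono {suc m} f≤g = +-mono-≤ (f≤g Fin.zero) (∑-mono (f≤g ∘ Fin.suc))

∑-const : ∀ m c → ∑[ i < m ] c ≡ m * c
∑-const zero    c = refl
∑-const (suc m) c = cong (c +_) (∑-const m c)

∑-one : ∀ m → ∑[ i < m ] 1 ≡ m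
∑-one m = trans (∑-const m 1) (*-identityʳ m)

term≤∑ : ∀ {m} (f : Fin m → ℕ) i → f i ≤ ∑[ j < m ] f j
term≤∑ f Fin.zero    = m≤m+n _ _
term≤∑ f (Fin.suc i) = ≤-trans (term≤∑ (f ∘ Fin.suc) i) (m≤n+m _ _)

∑-indicator : ∀ m k → ∑[ i < m ] ⟦ toℕ i ≡ᵇ k ⟧ ≡ ⟦ k <ᵇ m ⟧
∑-indicator zero    k       = refl
∑-indicator (suc m) zero    = cong suc (trans (∑-const m 0) (*-zeroʳ m))
∑-indicator (suc m) (suc k) = ∑-indicator m k

∑-same : ∀ {m} (x : Fin m) → ∑[ y < m ] ⟦ toℕ x ≡ᵇ toℕ y ⟧ ≡ 1
∑-same {m} x = begin
  ∑[ y < m ] ⟦ toℕ x ≡ᵇ toℕ y ⟧   ≡⟨ sum-cong-≗ {m} (λ y → cong ⟦_⟧ (≡ᵇ-sym (toℕ x) (toℕ y))) ⟩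
  ∑[ y < m ] ⟦ toℕ y ≡ᵇ toℕ x ⟧   ≡⟨ ∑-indicator m (toℕ x) ⟩
  ⟦ toℕ x <ᵇ m ⟧                  ≡⟨ T⇒⟦⟧≡1 (<⇒<ᵇ (toℕ<n x)) ⟩
  1                               ∎
  where open ≡-Reasoning

countB-concatMap : ∀ {A B : Set} (p : B → Bool) (f : A → List B) {m} (g : Fin m → A) →
                   countB p (concatMap f (tabulate g)) ≡ ∑[ i < m ] countB p (f (g i))
countB-concatMap p f {zero}  g = refl
countB-concatMap p f {suc m} g =
  trans (countB-++ p (f (g Fin.zero)) _) (cong (countB p (f (g Fin.zero)) +_) (countB-concatMap p f (g ∘ Fin.suc)))

countB-map : ∀ {A B : Set} (p : B → Bool) (f : A → B) {m} (g : Fin m → A) →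
             countB p (map f (tabulate g)) ≡ ∑[ i < m ] ⟦ p (f (g i)) ⟧
countB-map p f {zero}  g = refl
countB-map p f {suc m} g =
  trans (countB-∷ p (f (g Fin.zero)) _) (cong (⟦ p (f (g Fin.zero)) ⟧ +_) (countB-map p f (g ∘ Fin.suc)))

pathDegree : ∀ {m} → Fin m → ℕ
pathDegree {m} x = ∑[ y < m ] ⟦ dist1 (toℕ x) (toℕ y) ⟧

pathBoundary : ∀ {m} → Fin m → ℕ
pathBoundary {m} x = ⟦ toℕ x ≡ᵇ 0 ⟧ + ⟦ suc (toℕ x) ≡ᵇ m ⟧

pathDegree+pathBoundary≤2 : ∀ {m} (x : Fin m) → pathDegree x + pathBoundary x ≤ 2
pathDegree+pathBoundary≤2 {m} x = begin
  pathDegree x + pathBoundary x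
    ≤⟨ +-monoˡ-≤ (pathBoundary x) (≤-trans (∑-mono {m} (λ y → ⟦⟧-∨≤ (suc x′ ≡ᵇ toℕ y) _))
         (≤-reflexive (∑-distrib-+ {m} (λ y → ⟦ suc x′ ≡ᵇ toℕ y ⟧) (λ y → ⟦ suc (toℕ y) ≡ᵇ x′ ⟧)))) ⟩
  ∑[ y < m ] ⟦ suc x′ ≡ᵇ toℕ y ⟧ + ∑[ y < m ] ⟦ suc (toℕ y) ≡ᵇ x′ ⟧ + pathBoundary x
    ≤⟨ +-monoˡ-≤ (pathBoundary x) (+-mono-≤ (≤-reflexive successors) (predecessors x′)) ⟩
  ⟦ suc x′ <ᵇ m ⟧ + ⟦ 0 <ᵇ x′ ⟧ + (⟦ x′ ≡ᵇ 0 ⟧ + ⟦ suc x′ ≡ᵇ m ⟧)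
    ≡⟨ regroup ⟦ suc x′ <ᵇ m ⟧ ⟦ 0 <ᵇ x′ ⟧ ⟦ x′ ≡ᵇ 0 ⟧ ⟦ suc x′ ≡ᵇ m ⟧ ⟩
  (⟦ suc x′ <ᵇ m ⟧ + ⟦ suc x′ ≡ᵇ m ⟧) + (⟦ 0 <ᵇ x′ ⟧ + ⟦ x′ ≡ᵇ 0 ⟧)
    ≤⟨ +-mono-≤ (⟦<ᵇ⟧+⟦≡ᵇ⟧≤1 (suc x′) m) (⟦0<ᵇ⟧+⟦≡ᵇ0⟧≤1 x′) ⟩
  2 ∎
  where
  open ≤-Reasoning
  x′ = toℕ x
  regroup : ∀ a b c d → a + b + (c + d) ≡ a + d + (b + c)
  regroup = solve-∀
  successors : ∑[ y < m ] ⟦ suc x′ ≡ᵇ toℕ y ⟧ ≡ ⟦ suc x′ <ᵇ m ⟧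
  successors = trans (sum-cong-≗ {m} (λ y → cong ⟦_⟧ (≡ᵇ-sym (suc x′) (toℕ y)))) (∑-indicator m (suc x′))
  predecessors : ∀ z → ∑[ y < m ] ⟦ suc (toℕ y) ≡ᵇ z ⟧ ≤ ⟦ 0 <ᵇ z ⟧
  predecessors zero    = ≤-reflexive (trans (∑-const m 0) (*-zeroʳ m))
  predecessors (suc z) = ≤-trans (≤-reflexive (∑-indicator m z)) (⟦⟧≤1 (z <ᵇ m))

∑-pathBoundary : ∀ m .{{_ : NonZero m}} → ∑[ x < m ] pathBoundary x ≡ 2
∑-pathBoundary (suc m) = begin
  ∑[ x < suc m ] pathBoundary x
    ≡⟨ ∑-distrib-+ {suc m} (λ x → ⟦ toℕ x ≡ᵇ 0 ⟧) (λ x → ⟦ suc (toℕ x) ≡ᵇ suc m ⟧) ⟩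
  ∑[ x < suc m ] ⟦ toℕ x ≡ᵇ 0 ⟧ + ∑[ x < suc m ] ⟦ toℕ x ≡ᵇ m ⟧
    ≡⟨ cong₂ _+_ (∑-indicator (suc m) 0) (∑-indicator (suc m) m) ⟩
  1 + ⟦ m <ᵇ suc m ⟧
    ≡⟨ cong suc (T⇒⟦⟧≡1 (<⇒<ᵇ (n<1+n m))) ⟩
  2 ∎
  where open ≡-Reasoning

-- x₁ - y₁ ≤ x₀ - y₀ and x₂ - y₂ ≤ x₁ - y₁ give x₂ - y₂ ≤ x₀ - y₀, stated without subtraction.
exchange-trans : ∀ {x₀ x₁ x₂ y₀ y₁ y₂} → x₁ + y₀ ≤ x₀ + y₁ → x₂ + y₁ ≤ x₁ + y₂ → x₂ + y₀ ≤ x₀ + y₂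
exchange-trans {x₀} {x₁} {x₂} {y₀} {y₁} {y₂} le₁ le₂ = +-cancelʳ-≤ (x₁ + y₁) _ _ (begin
  x₂ + y₀ + (x₁ + y₁)   ≡⟨ swap x₂ y₀ x₁ y₁ ⟩
  x₂ + y₁ + (x₁ + y₀)   ≤⟨ +-mono-≤ le₂ le₁ ⟩
  x₁ + y₂ + (x₀ + y₁)   ≡⟨ swap′ x₁ y₂ x₀ y₁ ⟩
  x₀ + y₂ + (x₁ + y₁)   ∎)
  where
  open ≤-Reasoning
  swap : ∀ a b c d → a + b + (c + d) ≡ a + d + (c + b)
  swap = solve-∀
  swap′ : ∀ a b c d → a + b + (c + d) ≡ c + b + (a + d)
  swap′ = solve-∀

surface : ℕ → ℕ → ℕ → ℕ
surface a₁ a₂ a₃ = a₁ * a₂ + a₁ * a₃ + a₂ * a₃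

module _ {a₁ a₂ a₃ : ℕ} where

  ∑ᵛ : (Vertex a₁ a₂ a₃ → ℕ) → ℕ
  ∑ᵛ f = ∑[ i < a₁ ] ∑[ j < a₂ ] ∑[ k < a₃ ] f (i , j , k)

  ∑ᵛ-cong : ∀ {f g : Vertex a₁ a₂ a₃ → ℕ} → (∀ v → f v ≡ g v) → ∑ᵛ f ≡ ∑ᵛ g
  ∑ᵛ-cong f≗g = sum-cong-≗ λ i → sum-cong-≗ λ j → sum-cong-≗ λ k → f≗g (i , j , k)

  ∑ᵛ-mono : ∀ {f g : Vertex a₁ a₂ a₃ → ℕ} → (∀ v → f v ≤ g v) → ∑ᵛ f ≤ ∑ᵛ g
  ∑ᵛ-mono f≤g = ∑-mono λ i → ∑-mono λ j → ∑-mono λ k → f≤g (i , j , k)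

  ∑ᵛ-distrib-+ : ∀ (f g : Vertex a₁ a₂ a₃ → ℕ) → ∑ᵛ (λ v → f v + g v) ≡ ∑ᵛ f + ∑ᵛ g
  ∑ᵛ-distrib-+ f g = trans (sum-cong-≗ λ i →
    trans (sum-cong-≗ λ j → ∑-distrib-+ (λ k → f (i , j , k)) (λ k → g (i , j , k)))
          (∑-distrib-+ (λ j → ∑[ k < a₃ ] f (i , j , k)) (λ j → ∑[ k < a₃ ] g (i , j , k))))
    (∑-distrib-+ (λ i → ∑[ j < a₂ ] ∑[ k < a₃ ] f (i , j , k)) (λ i → ∑[ j < a₂ ] ∑[ k < a₃ ] g (i , j , k)))

  ∑ᵛ-distribˡ : ∀ c (f : Vertex a₁ a₂ a₃ → ℕ) → c * ∑ᵛ f ≡ ∑ᵛ (λ v → c * f v)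
  ∑ᵛ-distribˡ c f = trans (*-distribˡ-sum c (λ i → ∑[ j < a₂ ] ∑[ k < a₃ ] f (i , j , k))) (sum-cong-≗ λ i →
    trans (*-distribˡ-sum c (λ j → ∑[ k < a₃ ] f (i , j , k))) (sum-cong-≗ λ j →
    *-distribˡ-sum c (λ k → f (i , j , k))))

  term≤∑ᵛ : ∀ (f : Vertex a₁ a₂ a₃ → ℕ) v → f v ≤ ∑ᵛ f
  term≤∑ᵛ f (i , j , k) = ≤-trans (term≤∑ (λ k → f (i , j , k)) k)
    (≤-trans (term≤∑ (λ j → ∑[ k < a₃ ] f (i , j , k)) j) (term≤∑ (λ i → ∑[ j < a₂ ] ∑[ k < a₃ ] f (i , j , k)) i))

  ∑-∑ᵛ-comm : ∀ {m} (f : Fin m → Vertex a₁ a₂ a₃ → ℕ) → ∑[ l < m ] ∑ᵛ (f l) ≡ ∑ᵛ (λ w → ∑[ l < m ] f l w)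
  ∑-∑ᵛ-comm f = trans (∑-comm λ l i → ∑[ j < a₂ ] ∑[ k < a₃ ] f l (i , j , k)) (sum-cong-≗ λ i →
                trans (∑-comm λ l j → ∑[ k < a₃ ] f l (i , j , k)) (sum-cong-≗ λ j →
                ∑-comm λ l k → f l (i , j , k)))

  ∑ᵛ-comm : ∀ (f : Vertex a₁ a₂ a₃ → Vertex a₁ a₂ a₃ → ℕ) →
            ∑ᵛ (λ v → ∑ᵛ (f v)) ≡ ∑ᵛ (λ w → ∑ᵛ (λ v → f v w))
  ∑ᵛ-comm f = trans (sum-cong-≗ λ i →
    trans (sum-cong-≗ λ j → ∑-∑ᵛ-comm λ k → f (i , j , k))
          (∑-∑ᵛ-comm λ j w → ∑[ k < a₃ ] f (i , j , k) w))
    (∑-∑ᵛ-comm λ i w → ∑[ j < a₂ ] ∑[ k < a₃ ] f (i , j , k) w)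

  countB-vertices : ∀ (p : Vertex a₁ a₂ a₃ → Bool) → countB p (vertices a₁ a₂ a₃) ≡ ∑ᵛ (⟦_⟧ ∘ p)
  countB-vertices p =
    trans (countB-concatMap p (λ i → concatMap (λ j → map (λ k → i , j , k) (allFin a₃)) (allFin a₂)) id)
      (sum-cong-≗ λ i → trans (countB-concatMap p (λ j → map (λ k → i , j , k) (allFin a₃)) id)
        (sum-cong-≗ λ j → countB-map p (λ k → i , j , k) id))

  size≡∑ᵛ : ∀ (B : VSet a₁ a₂ a₃) → size B ≡ ∑ᵛ (⟦_⟧ ∘ B)
  size≡∑ᵛ = countB-vertices

  nbrsIn≡∑ᵛ : ∀ (B : VSet a₁ a₂ a₃) v → nbrsIn B v ≡ ∑ᵛ (λ w → ⟦ adj v w ∧ B w ⟧)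
  nbrsIn≡∑ᵛ B v = countB-vertices _

  _≟ᵛ_ : DecidableEquality (Vertex a₁ a₂ a₃)
  _≟ᵛ_ = ≡-dec Fin._≟_ (≡-dec Fin._≟_ Fin._≟_)

  ∈-vertices : (v : Vertex a₁ a₂ a₃) → v ∈ vertices a₁ a₂ a₃
  ∈-vertices (i , j , k) =
    ∈-concatMap⁺ _ (Any.map (λ { refl →
      ∈-concatMap⁺ _ (Any.map (λ { refl → ∈-map⁺ _ (∈-allFin k) }) (∈-allFin j)) }) (∈-allFin i))

  adj-sym : ∀ (v w : Vertex a₁ a₂ a₃) → adj v w ≡ adj w v
  adj-sym (x₁ , x₂ , x₃) (y₁ , y₂ , y₃)
    rewrite dist1-sym (toℕ x₁) (toℕ y₁) | dist1-sym (toℕ x₂) (toℕ y₂) | dist1-sym (toℕ x₃) (toℕ y₃)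
          | ≡ᵇ-sym (toℕ x₁) (toℕ y₁) | ≡ᵇ-sym (toℕ x₂) (toℕ y₂) | ≡ᵇ-sym (toℕ x₃) (toℕ y₃) = refl

  module _ (A : VSet a₁ a₂ a₃) where

    stage-mono : ∀ {t t' v} → t ≤ t' → T (stage t A v) → T (stage t' A v)
    stage-mono t≤t' = go (≤⇒≤′ t≤t')
      where
      go : ∀ {t t' v} → t ≤′ t' → T (stage t A v) → T (stage t' A v)
      go ≤′-refl          v∈ = v∈
      go (≤′-step t≤′t') v∈ = from T-∨ (inj₁ (go t≤′t' v∈))

    percolation-time : Percolates A → ∃ λ t → ∀ v → T (stage t A v)
    percolation-time perc = proj₁ all-by , λ v → proj₂ all-by (∈-vertices v)
      where
      uniform : ∀ xs → ∃ λ t → ∀ {v} → v ∈ xs → T (stage t A v)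
      uniform []       = 0 , λ ()
      uniform (x ∷ xs) with perc x | uniform xs
      ... | t , x∈ | t' , xs∈ = t ⊔ t' , λ { (here refl)  → stage-mono (m≤m⊔n t t') x∈
                                         ; (there v∈xs) → stage-mono (m≤n⊔m t t') (xs∈ v∈xs) }
      all-by = uniform (vertices a₁ a₂ a₃)

    data Infected : Vertex a₁ a₂ a₃ → Set where
      seed   : ∀ {v} → T (A v) → Infected v
      spread : ∀ {v w₁ w₂ w₃} → T (adj v w₁) → T (adj v w₂) → T (adj v w₃) →
               w₁ ≢ w₂ → w₁ ≢ w₃ → w₂ ≢ w₃ →
               Infected w₁ → Infected w₂ → Infected w₃ → Infected v

    Infected⇒stage : ∀ {v} → Infected v → ∃ λ t → T (stage t A v)
    Infected⇒stage (seed v∈A) = 0 , v∈A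
    Infected⇒stage {v} (spread v~w₁ v~w₂ v~w₃ w₁≢w₂ w₁≢w₃ w₂≢w₃ inf₁ inf₂ inf₃)
      with Infected⇒stage inf₁ | Infected⇒stage inf₂ | Infected⇒stage inf₃
    ... | t₁ , w₁∈ | t₂ , w₂∈ | t₃ , w₃∈ = suc t , from T-∨ (inj₂ (≤⇒≤ᵇ three-infected-neighbours))
      where
      t = t₁ ⊔ t₂ ⊔ t₃
      infected-neighbour : ∀ {w tᵢ} → T (adj v w) → tᵢ ≤ t → T (stage tᵢ A w) → T (adj v w ∧ stage t A w)
      infected-neighbour v~w tᵢ≤t w∈ = from T-∧ (v~w , stage-mono tᵢ≤t w∈)
      three-infected-neighbours : 3 ≤ nbrsIn (stage t A) v
      three-infected-neighbours =
        three≤countB _≟ᵛ_ _ (vertices a₁ a₂ a₃) (∈-vertices _) (∈-vertices _) (∈-vertices _)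
          w₁≢w₂ w₁≢w₃ w₂≢w₃
          (infected-neighbour v~w₁ (≤-trans (m≤m⊔n t₁ t₂) (m≤m⊔n _ t₃)) w₁∈)
          (infected-neighbour v~w₂ (≤-trans (m≤n⊔m t₁ t₂) (m≤m⊔n _ t₃)) w₂∈)
          (infected-neighbour v~w₃ (m≤n⊔m (t₁ ⊔ t₂) t₃) w₃∈)

  -- The perimeter bound

  degreeSum : VSet a₁ a₂ a₃ → ℕ
  degreeSum B = ∑ᵛ λ v → ⟦ B v ⟧ * nbrsIn B v

  newlyInfected : VSet a₁ a₂ a₃ → VSet a₁ a₂ a₃
  newlyInfected B v = not (B v) ∧ (3 ≤ᵇ nbrsIn B v)

  size-step : ∀ B → size (step B) ≡ size B + size (newlyInfected B)
  size-step B = begin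
    size (step B)                                ≡⟨ size≡∑ᵛ (step B) ⟩
    ∑ᵛ (λ v → ⟦ step B v ⟧)                      ≡⟨ ∑ᵛ-cong (λ v → ⟦⟧-∨ (B v) _) ⟩
    ∑ᵛ (λ v → ⟦ B v ⟧ + ⟦ newlyInfected B v ⟧)    ≡⟨ ∑ᵛ-distrib-+ (⟦_⟧ ∘ B) (⟦_⟧ ∘ newlyInfected B) ⟩
    ∑ᵛ (⟦_⟧ ∘ B) + ∑ᵛ (⟦_⟧ ∘ newlyInfected B)     ≡⟨ sym (cong₂ _+_ (size≡∑ᵛ B) (size≡∑ᵛ (newlyInfected B))) ⟩
    size B + size (newlyInfected B)              ∎
    where open ≡-Reasoning

  nbrsIn-step : ∀ B v → nbrsIn (step B) v ≡ nbrsIn B v + nbrsIn (newlyInfected B) v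
  nbrsIn-step B v = begin
    nbrsIn (step B) v
      ≡⟨ nbrsIn≡∑ᵛ (step B) v ⟩
    ∑ᵛ (λ w → ⟦ adj v w ∧ step B w ⟧)
      ≡⟨ ∑ᵛ-cong (λ w → ⟦⟧-∧∨ (adj v w) (B w) _) ⟩
    ∑ᵛ (λ w → ⟦ adj v w ∧ B w ⟧ + ⟦ adj v w ∧ newlyInfected B w ⟧)
      ≡⟨ ∑ᵛ-distrib-+ (λ w → ⟦ adj v w ∧ B w ⟧) (λ w → ⟦ adj v w ∧ newlyInfected B w ⟧) ⟩
    ∑ᵛ (λ w → ⟦ adj v w ∧ B w ⟧) + ∑ᵛ (λ w → ⟦ adj v w ∧ newlyInfected B w ⟧)
      ≡⟨ sym (cong₂ _+_ (nbrsIn≡∑ᵛ B v) (nbrsIn≡∑ᵛ (newlyInfected B) v)) ⟩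
    nbrsIn B v + nbrsIn (newlyInfected B) v ∎
    where open ≡-Reasoning

  cross-degree-sym : ∀ (P Q : VSet a₁ a₂ a₃) →
                     ∑ᵛ (λ v → ⟦ P v ⟧ * nbrsIn Q v) ≡ ∑ᵛ (λ v → ⟦ Q v ⟧ * nbrsIn P v)
  cross-degree-sym P Q = begin
    ∑ᵛ (λ v → ⟦ P v ⟧ * nbrsIn Q v)
      ≡⟨ ∑ᵛ-cong (λ v → trans (cong (⟦ P v ⟧ *_) (nbrsIn≡∑ᵛ Q v)) (∑ᵛ-distribˡ ⟦ P v ⟧ (λ w → ⟦ adj v w ∧ Q w ⟧))) ⟩
    ∑ᵛ (λ v → ∑ᵛ (λ w → ⟦ P v ⟧ * ⟦ adj v w ∧ Q w ⟧))
      ≡⟨ ∑ᵛ-comm (λ v w → ⟦ P v ⟧ * ⟦ adj v w ∧ Q w ⟧) ⟩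
    ∑ᵛ (λ w → ∑ᵛ (λ v → ⟦ P v ⟧ * ⟦ adj v w ∧ Q w ⟧))
      ≡⟨ ∑ᵛ-cong (λ w → ∑ᵛ-cong (λ v → swap-term v w)) ⟩
    ∑ᵛ (λ w → ∑ᵛ (λ v → ⟦ Q w ⟧ * ⟦ adj w v ∧ P v ⟧))
      ≡⟨ ∑ᵛ-cong (λ w → trans (sym (∑ᵛ-distribˡ ⟦ Q w ⟧ (λ v → ⟦ adj w v ∧ P v ⟧))) (cong (⟦ Q w ⟧ *_) (sym (nbrsIn≡∑ᵛ P w)))) ⟩
    ∑ᵛ (λ w → ⟦ Q w ⟧ * nbrsIn P w) ∎
    where
    open ≡-Reasoning
    swap-term : ∀ v w → ⟦ P v ⟧ * ⟦ adj v w ∧ Q w ⟧ ≡ ⟦ Q w ⟧ * ⟦ adj w v ∧ P v ⟧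
    swap-term v w = trans (⟦⟧-swap (P v) (adj v w) (Q w)) (cong (λ a → ⟦ Q w ⟧ * ⟦ a ∧ P v ⟧) (adj-sym v w))

  3*size-newlyInfected≤ : ∀ B → 3 * size (newlyInfected B) ≤ ∑ᵛ (λ v → ⟦ newlyInfected B v ⟧ * nbrsIn B v)
  3*size-newlyInfected≤ B = begin
    3 * size (newlyInfected B)                     ≡⟨ cong (3 *_) (size≡∑ᵛ (newlyInfected B)) ⟩
    3 * ∑ᵛ (⟦_⟧ ∘ newlyInfected B)                 ≡⟨ ∑ᵛ-distribˡ 3 (⟦_⟧ ∘ newlyInfected B) ⟩
    ∑ᵛ (λ v → 3 * ⟦ newlyInfected B v ⟧)            ≤⟨ ∑ᵛ-mono at-least-three ⟩
    ∑ᵛ (λ v → ⟦ newlyInfected B v ⟧ * nbrsIn B v)   ∎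
    where
    open ≤-Reasoning
    at-least-three : ∀ v → 3 * ⟦ newlyInfected B v ⟧ ≤ ⟦ newlyInfected B v ⟧ * nbrsIn B v
    at-least-three v with newlyInfected B v in new
    ... | false = z≤n
    ... | true  = +-monoˡ-≤ 0 (≤ᵇ⇒≤ 3 _ (proj₂ (to T-∧ (subst T (sym new) tt))))

  potential-step : ∀ B → 6 * size (step B) + degreeSum B ≤ 6 * size B + degreeSum (step B)
  potential-step B = begin
    6 * size (step B) + degreeSum B                        ≡⟨ cong (λ s → 6 * s + degreeSum B) (size-step B) ⟩
    6 * (size B + size N) + degreeSum B                    ≡⟨ rearrange (size B) (size N) (degreeSum B) ⟩
    6 * size B + (degreeSum B + (3 * size N + 3 * size N))  ≤⟨ +-monoʳ-≤ (6 * size B) (+-monoʳ-≤ (degreeSum B) (+-mono-≤ 3N≤X 3N≤Y)) ⟩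
    6 * size B + (degreeSum B + (X + Y))                   ≤⟨ +-monoʳ-≤ (6 * size B) grow ⟩
    6 * size B + degreeSum (step B)                        ∎
    where
    open ≤-Reasoning
    N = newlyInfected B
    X = ∑ᵛ (λ v → ⟦ B v ⟧ * nbrsIn N v)
    Y = ∑ᵛ (λ v → ⟦ N v ⟧ * nbrsIn B v)
    3N≤Y : 3 * size N ≤ Y
    3N≤Y = 3*size-newlyInfected≤ B
    3N≤X : 3 * size N ≤ X
    3N≤X = ≤-trans 3N≤Y (≤-reflexive (sym (cross-degree-sym B N)))
    rearrange : ∀ s n d → 6 * (s + n) + d ≡ 6 * s + (d + (3 * n + 3 * n))
    rearrange = solve-∀
    expand : ∀ b n x y → b * x + (b * y + n * x) ≤ (b + n) * (x + y)
    expand b n x y = subst (b * x + (b * y + n * x) ≤_) (sym (eq b n x y)) (m≤m+n _ (n * y))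
      where
      eq : ∀ b n x y → (b + n) * (x + y) ≡ b * x + (b * y + n * x) + n * y
      eq = solve-∀
    grow : degreeSum B + (X + Y) ≤ degreeSum (step B)
    grow = begin
      degreeSum B + (X + Y)
        ≡⟨ sym (trans (∑ᵛ-distrib-+ (λ v → ⟦ B v ⟧ * nbrsIn B v) (λ v → ⟦ B v ⟧ * nbrsIn N v + ⟦ N v ⟧ * nbrsIn B v))
                      (cong (degreeSum B +_) (∑ᵛ-distrib-+ (λ v → ⟦ B v ⟧ * nbrsIn N v) (λ v → ⟦ N v ⟧ * nbrsIn B v)))) ⟩
      ∑ᵛ (λ v → ⟦ B v ⟧ * nbrsIn B v + (⟦ B v ⟧ * nbrsIn N v + ⟦ N v ⟧ * nbrsIn B v))
        ≤⟨ ∑ᵛ-mono (λ v → expand ⟦ B v ⟧ ⟦ N v ⟧ (nbrsIn B v) (nbrsIn N v)) ⟩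
      ∑ᵛ (λ v → (⟦ B v ⟧ + ⟦ N v ⟧) * (nbrsIn B v + nbrsIn N v))
        ≡⟨ ∑ᵛ-cong (λ v → sym (cong₂ _*_ (⟦⟧-∨ (B v) _) (nbrsIn-step B v))) ⟩
      degreeSum (step B) ∎

  potential-stage : ∀ A t → 6 * size (stage t A) + degreeSum A ≤ 6 * size A + degreeSum (stage t A)
  potential-stage A zero    = ≤-refl
  potential-stage A (suc t) = exchange-trans {y₀ = degreeSum A} (potential-stage A t) (potential-step (stage t A))

  full : VSet a₁ a₂ a₃
  full _ = true

  ∑ᵛ-product : ∀ (f : Fin a₁ → ℕ) (g : Fin a₂ → ℕ) (h : Fin a₃ → ℕ) →
               ∑ᵛ (λ (i , j , k) → f i * (g j * h k))
                 ≡ (∑[ i < a₁ ] f i) * ((∑[ j < a₂ ] g j) * (∑[ k < a₃ ] h k))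
  ∑ᵛ-product f g h = begin
    ∑[ i < a₁ ] ∑[ j < a₂ ] ∑[ k < a₃ ] (f i * (g j * h k))
      ≡⟨ sum-cong-≗ {a₁} (λ i → sum-cong-≗ {a₂} (λ j → inner i j)) ⟩
    ∑[ i < a₁ ] ∑[ j < a₂ ] (f i * (g j * H))   ≡⟨ sum-cong-≗ {a₁} middle ⟩
    ∑[ i < a₁ ] (f i * (G * H))                 ≡⟨ sym (*-distribʳ-sum (G * H) f) ⟩
    (∑[ i < a₁ ] f i) * (G * H)                 ∎
    where
    open ≡-Reasoning
    G = ∑[ j < a₂ ] g j
    H = ∑[ k < a₃ ] h k
    inner : ∀ i j → ∑[ k < a₃ ] (f i * (g j * h k)) ≡ f i * (g j * H)
    inner i j = trans (sym (*-distribˡ-sum (f i) (λ k → g j * h k))) (cong (f i *_) (sym (*-distribˡ-sum (g j) h)))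
    middle : ∀ i → ∑[ j < a₂ ] (f i * (g j * H)) ≡ f i * (G * H)
    middle i = trans (sym (*-distribˡ-sum (f i) (λ j → g j * H))) (cong (f i *_) (sym (*-distribʳ-sum H g)))

  ∑ᵛ-axes : ∀ (α : Fin a₁ → Bool) (β : Fin a₂ → Bool) (γ : Fin a₃ → Bool) →
            ∑ᵛ (λ (i , j , k) → ⟦ α i ∧ β j ∧ γ k ⟧)
              ≡ (∑[ i < a₁ ] ⟦ α i ⟧) * ((∑[ j < a₂ ] ⟦ β j ⟧) * (∑[ k < a₃ ] ⟦ γ k ⟧))
  ∑ᵛ-axes α β γ = trans (∑ᵛ-cong λ (i , j , k) → trans (⟦⟧-∧ (α i) _) (cong (⟦ α i ⟧ *_) (⟦⟧-∧ (β j) (γ k))))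
                        (∑ᵛ-product (⟦_⟧ ∘ α) (⟦_⟧ ∘ β) (⟦_⟧ ∘ γ))

  degree≤pathDegrees : ∀ x₁ x₂ x₃ → nbrsIn full (x₁ , x₂ , x₃) ≤ pathDegree x₁ + pathDegree x₂ + pathDegree x₃
  degree≤pathDegrees x₁ x₂ x₃ = begin
    nbrsIn full v                                  ≡⟨ nbrsIn≡∑ᵛ full v ⟩
    ∑ᵛ (λ w → ⟦ adj v w ∧ true ⟧)                  ≤⟨ ∑ᵛ-mono split ⟩
    ∑ᵛ (λ w → ⟦ c₁ w ⟧ + ⟦ c₂ w ⟧ + ⟦ c₃ w ⟧)
      ≡⟨ trans (∑ᵛ-distrib-+ (λ w → ⟦ c₁ w ⟧ + ⟦ c₂ w ⟧) (⟦_⟧ ∘ c₃))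
               (cong (_+ ∑ᵛ (⟦_⟧ ∘ c₃)) (∑ᵛ-distrib-+ (⟦_⟧ ∘ c₁) (⟦_⟧ ∘ c₂))) ⟩
    ∑ᵛ (⟦_⟧ ∘ c₁) + ∑ᵛ (⟦_⟧ ∘ c₂) + ∑ᵛ (⟦_⟧ ∘ c₃)
      ≡⟨ cong₂ _+_ (cong₂ _+_ (∑ᵛ-axes (λ y → dist1 (toℕ x₁) (toℕ y)) (same x₂) (same x₃))
                              (∑ᵛ-axes (same x₁) (λ y → dist1 (toℕ x₂) (toℕ y)) (same x₃)))
                   (∑ᵛ-axes (same x₁) (same x₂) (λ y → dist1 (toℕ x₃) (toℕ y))) ⟩
    pathDegree x₁ * (∑s x₂ * ∑s x₃) + ∑s x₁ * (pathDegree x₂ * ∑s x₃) + ∑s x₁ * (∑s x₂ * pathDegree x₃)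
      ≡⟨ cong₂ _+_ (cong₂ _+_ (cong₂ (λ a b → pathDegree x₁ * (a * b)) (∑-same x₂) (∑-same x₃))
                              (cong₂ (λ a b → a * (pathDegree x₂ * b)) (∑-same x₁) (∑-same x₃)))
                   (cong₂ (λ a b → a * (b * pathDegree x₃)) (∑-same x₁) (∑-same x₂)) ⟩
    pathDegree x₁ * (1 * 1) + 1 * (pathDegree x₂ * 1) + 1 * (1 * pathDegree x₃)
      ≡⟨ units (pathDegree x₁) (pathDegree x₂) (pathDegree x₃) ⟩
    pathDegree x₁ + pathDegree x₂ + pathDegree x₃ ∎
    where
    open ≤-Reasoning
    v = x₁ , x₂ , x₃
    same : ∀ {m} → Fin m → Fin m → Bool
    same x y = toℕ x ≡ᵇ toℕ y
    ∑s : ∀ {m} → Fin m → ℕ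
    ∑s {m} x = ∑[ y < m ] ⟦ same x y ⟧
    c₁ c₂ c₃ : Vertex a₁ a₂ a₃ → Bool
    c₁ (y₁ , y₂ , y₃) = dist1 (toℕ x₁) (toℕ y₁) ∧ same x₂ y₂ ∧ same x₃ y₃
    c₂ (y₁ , y₂ , y₃) = same x₁ y₁ ∧ dist1 (toℕ x₂) (toℕ y₂) ∧ same x₃ y₃
    c₃ (y₁ , y₂ , y₃) = same x₁ y₁ ∧ same x₂ y₂ ∧ dist1 (toℕ x₃) (toℕ y₃)
    split : ∀ w → ⟦ adj v w ∧ true ⟧ ≤ ⟦ c₁ w ⟧ + ⟦ c₂ w ⟧ + ⟦ c₃ w ⟧
    split w@(y₁ , y₂ , y₃) rewrite ∧-identityʳ (adj v w) =
      ≤-trans (⟦⟧-∨≤ (c₁ w) _)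
        (≤-trans (+-monoʳ-≤ ⟦ c₁ w ⟧ (⟦⟧-∨≤ (c₂ w) (c₃ w))) (≤-reflexive (sym (+-assoc ⟦ c₁ w ⟧ _ _))))
    units : ∀ a b c → a * (1 * 1) + 1 * (b * 1) + 1 * (1 * c) ≡ a + b + c
    units = solve-∀

  boundary : Vertex a₁ a₂ a₃ → ℕ
  boundary (i , j , k) = pathBoundary i + pathBoundary j + pathBoundary k

  degree+boundary≤6 : ∀ v → nbrsIn full v + boundary v ≤ 6
  degree+boundary≤6 v@(i , j , k) = begin
    nbrsIn full v + boundary v
      ≤⟨ +-monoˡ-≤ (boundary v) (degree≤pathDegrees i j k) ⟩
    pathDegree i + pathDegree j + pathDegree k + (pathBoundary i + pathBoundary j + pathBoundary k)
      ≡⟨ regroup (pathDegree i) (pathDegree j) (pathDegree k) (pathBoundary i) (pathBoundary j) (pathBoundary k) ⟩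
    (pathDegree i + pathBoundary i) + (pathDegree j + pathBoundary j) + (pathDegree k + pathBoundary k)
      ≤⟨ +-mono-≤ (+-mono-≤ (pathDegree+pathBoundary≤2 i) (pathDegree+pathBoundary≤2 j)) (pathDegree+pathBoundary≤2 k) ⟩
    6 ∎
    where
    open ≤-Reasoning
    regroup : ∀ a b c d e f → a + b + c + (d + e + f) ≡ (a + d) + (b + e) + (c + f)
    regroup = solve-∀

  ∑ᵛ-separable : ∀ (f : Fin a₁ → ℕ) (g : Fin a₂ → ℕ) (h : Fin a₃ → ℕ) →
                 ∑ᵛ (λ (i , j , k) → f i + g j + h k)
                   ≡ (∑[ i < a₁ ] f i) * (a₂ * a₃) + a₁ * ((∑[ j < a₂ ] g j) * a₃) + a₁ * (a₂ * (∑[ k < a₃ ] h k))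
  ∑ᵛ-separable f g h = begin
    ∑ᵛ (λ (i , j , k) → f i + g j + h k)
      ≡⟨ trans (∑ᵛ-distrib-+ (λ (i , j , k) → f i + g j) (λ (i , j , k) → h k))
               (cong (_+ ∑ᵛ (λ (i , j , k) → h k)) (∑ᵛ-distrib-+ (λ (i , j , k) → f i) (λ (i , j , k) → g j))) ⟩
    ∑ᵛ (λ (i , j , k) → f i) + ∑ᵛ (λ (i , j , k) → g j) + ∑ᵛ (λ (i , j , k) → h k)
      ≡⟨ cong₂ _+_ (cong₂ _+_ (trans (∑ᵛ-cong λ (i , j , k) → sym (*-identityʳ (f i))) (∑ᵛ-product f one one))
                              (trans (∑ᵛ-cong λ (i , j , k) → sym (trans (*-identityˡ _) (*-identityʳ (g j)))) (∑ᵛ-product one g one)))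
                   (trans (∑ᵛ-cong λ (i , j , k) → sym (trans (*-identityˡ _) (*-identityˡ (h k)))) (∑ᵛ-product one one h)) ⟩
    F * (∑1 a₂ * ∑1 a₃) + ∑1 a₁ * (G * ∑1 a₃) + ∑1 a₁ * (∑1 a₂ * H)
      ≡⟨ cong₂ _+_ (cong₂ _+_ (cong (F *_) (cong₂ _*_ (∑-one a₂) (∑-one a₃)))
                              (cong₂ (λ x y → x * (G * y)) (∑-one a₁) (∑-one a₃)))
                   (cong₂ (λ x y → x * (y * H)) (∑-one a₁) (∑-one a₂)) ⟩
    F * (a₂ * a₃) + a₁ * (G * a₃) + a₁ * (a₂ * H) ∎
    where
    open ≡-Reasoning
    one : ∀ {m} → Fin m → ℕ
    one _ = 1
    ∑1 : ℕ → ℕ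
    ∑1 m = ∑[ i < m ] 1
    F = ∑[ i < a₁ ] f i
    G = ∑[ j < a₂ ] g j
    H = ∑[ k < a₃ ] h k

  ∑ᵛ-const : ∀ c → ∑ᵛ (λ _ → c) ≡ a₁ * (a₂ * (a₃ * c))
  ∑ᵛ-const c = trans (sum-cong-≗ {a₁} λ i → trans (sum-cong-≗ {a₂} λ j → ∑-const a₃ c) (∑-const a₂ (a₃ * c)))
                     (∑-const a₁ (a₂ * (a₃ * c)))

  nbrsIn-cong : ∀ {B B' : VSet a₁ a₂ a₃} → (∀ v → B v ≡ B' v) → ∀ v → nbrsIn B v ≡ nbrsIn B' v
  nbrsIn-cong {B} {B'} B≗B' v = trans (nbrsIn≡∑ᵛ B v)
    (trans (∑ᵛ-cong λ w → cong (λ b → ⟦ adj v w ∧ b ⟧) (B≗B' w)) (sym (nbrsIn≡∑ᵛ B' v)))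

  degreeSum-cong : ∀ {B B' : VSet a₁ a₂ a₃} → (∀ v → B v ≡ B' v) → degreeSum B ≡ degreeSum B'
  degreeSum-cong B≗B' = ∑ᵛ-cong λ v → cong₂ _*_ (cong ⟦_⟧ (B≗B' v)) (nbrsIn-cong B≗B' v)

  degreeSum-full : .{{_ : NonZero a₁}} .{{_ : NonZero a₂}} .{{_ : NonZero a₃}} →
                   degreeSum full + 2 * surface a₁ a₂ a₃ ≤ 6 * (a₁ * a₂ * a₃)
  degreeSum-full = begin
    degreeSum full + 2 * surface a₁ a₂ a₃
      ≡⟨ cong₂ _+_ (∑ᵛ-cong λ v → *-identityˡ (nbrsIn full v)) (sym ∑ᵛ-boundary) ⟩
    ∑ᵛ (nbrsIn full) + ∑ᵛ boundary         ≡⟨ sym (∑ᵛ-distrib-+ (nbrsIn full) boundary) ⟩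
    ∑ᵛ (λ v → nbrsIn full v + boundary v)   ≤⟨ ∑ᵛ-mono degree+boundary≤6 ⟩
    ∑ᵛ (λ _ → 6)                            ≡⟨ ∑ᵛ-const 6 ⟩
    a₁ * (a₂ * (a₃ * 6))                     ≡⟨ volume a₁ a₂ a₃ ⟩
    6 * (a₁ * a₂ * a₃)                       ∎
    where
    open ≤-Reasoning
    volume : ∀ x y z → x * (y * (z * 6)) ≡ 6 * (x * y * z)
    volume = solve-∀
    twice : ∀ x y z → 2 * (y * z) + x * (2 * z) + x * (y * 2) ≡ 2 * (x * y + x * z + y * z)
    twice = solve-∀
    ∑ᵛ-boundary : ∑ᵛ boundary ≡ 2 * surface a₁ a₂ a₃
    ∑ᵛ-boundary = begin-equality
      ∑ᵛ boundary
        ≡⟨ ∑ᵛ-separable pathBoundary pathBoundary pathBoundary ⟩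
      (∑[ i < a₁ ] pathBoundary i) * (a₂ * a₃) + a₁ * ((∑[ j < a₂ ] pathBoundary j) * a₃)
        + a₁ * (a₂ * (∑[ k < a₃ ] pathBoundary k))
        ≡⟨ cong₂ _+_ (cong₂ _+_ (cong (_* (a₂ * a₃)) (∑-pathBoundary a₁))
                                (cong (λ s → a₁ * (s * a₃)) (∑-pathBoundary a₂)))
                     (cong (λ s → a₁ * (a₂ * s)) (∑-pathBoundary a₃)) ⟩
      2 * (a₂ * a₃) + a₁ * (2 * a₃) + a₁ * (a₂ * 2)
        ≡⟨ twice a₁ a₂ a₃ ⟩
      2 * surface a₁ a₂ a₃ ∎

  perimeter-bound : .{{_ : NonZero a₁}} .{{_ : NonZero a₂}} .{{_ : NonZero a₃}} →
                    ∀ (A : VSet a₁ a₂ a₃) → Percolates A →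
                    2 * surface a₁ a₂ a₃ + degreeSum A ≤ 6 * size A
  perimeter-bound A perc = +-cancelʳ-≤ (6 * V) _ _ (begin
    2 * S + degreeSum A + 6 * V                 ≡⟨ +-assoc (2 * S) (degreeSum A) (6 * V) ⟩
    2 * S + (degreeSum A + 6 * V)               ≡⟨ cong (2 * S +_) (+-comm (degreeSum A) (6 * V)) ⟩
    2 * S + (6 * V + degreeSum A)               ≤⟨ +-monoʳ-≤ (2 * S) final-potential ⟩
    2 * S + (6 * size A + degreeSum full)       ≡⟨ rotate (2 * S) (6 * size A) (degreeSum full) ⟩
    6 * size A + (degreeSum full + 2 * S)       ≤⟨ +-monoʳ-≤ (6 * size A) degreeSum-full ⟩
    6 * size A + 6 * V                          ∎)
    where
    open ≤-Reasoning
    S = surface a₁ a₂ a₃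
    V = a₁ * a₂ * a₃
    rotate : ∀ a b c → a + (b + c) ≡ b + (c + a)
    rotate = solve-∀
    t = proj₁ (percolation-time A perc)
    B = stage t A
    B≗full : ∀ v → B v ≡ full v
    B≗full v = to T-≡ (proj₂ (percolation-time A perc) v)
    reassoc : ∀ x y z → x * (y * (z * 1)) ≡ x * y * z
    reassoc = solve-∀
    size-B : size B ≡ V
    size-B = trans (size≡∑ᵛ B)
               (trans (∑ᵛ-cong λ v → cong ⟦_⟧ (B≗full v)) (trans (∑ᵛ-const 1) (reassoc a₁ a₂ a₃)))
    final-potential : 6 * V + degreeSum A ≤ 6 * size A + degreeSum full
    final-potential = subst₂ (λ s d → 6 * s + degreeSum A ≤ 6 * size A + d) size-B (degreeSum-cong B≗full)
                        (potential-stage A t)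

  -- Each round is tabulated, so that evaluating spread* shares a round between all the
  -- vertices of the next round that consult it.

  Table : Set
  Table = Vec (Vec (Vec Bool a₃) a₂) a₁

  tabulate³ : VSet a₁ a₂ a₃ → Table
  tabulate³ S = Vec.tabulate λ i → Vec.tabulate λ j → Vec.tabulate λ k → S (i , j , k)

  lookup³ : Table → VSet a₁ a₂ a₃
  lookup³ tbl (i , j , k) = Vec.lookup (Vec.lookup (Vec.lookup tbl i) j) k

  memo : VSet a₁ a₂ a₃ → VSet a₁ a₂ a₃
  memo S = lookup³ (tabulate³ S)

  memo-correct : ∀ S v → memo S v ≡ S v
  memo-correct S (i , j , k) = begin
    Vec.lookup (Vec.lookup (Vec.lookup (tabulate³ S) i) j) k
      ≡⟨ cong (λ row → Vec.lookup (Vec.lookup row j) k) (lookup∘tabulate _ i) ⟩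
    Vec.lookup (Vec.lookup (Vec.tabulate λ j → Vec.tabulate λ k → S (i , j , k)) j) k
      ≡⟨ cong (λ col → Vec.lookup col k) (lookup∘tabulate _ j) ⟩
    Vec.lookup (Vec.tabulate λ k → S (i , j , k)) k
      ≡⟨ lookup∘tabulate _ k ⟩
    S (i , j , k) ∎
    where open ≡-Reasoning

  -- The distinctness test never fails on neighbour lists; it only spares the soundness
  -- proof from reasoning about axisLines.
  threeDistinct : List (Vertex a₁ a₂ a₃) → Bool
  threeDistinct (x ∷ y ∷ z ∷ _) = _≢ᵇ_ _≟ᵛ_ x y ∧ _≢ᵇ_ _≟ᵛ_ x z ∧ _≢ᵇ_ _≟ᵛ_ y z
  threeDistinct _               = false

  axisLines : Vertex a₁ a₂ a₃ → List (Vertex a₁ a₂ a₃)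
  axisLines (i , j , k) = map (λ i′ → i′ , j , k) (allFin a₁) ++ map (λ j′ → i , j′ , k) (allFin a₂)
                          ++ map (λ k′ → i , j , k′) (allFin a₃)

  infectedNeighbours : VSet a₁ a₂ a₃ → Vertex a₁ a₂ a₃ → List (Vertex a₁ a₂ a₃)
  infectedNeighbours S v = filterᵇ (λ w → adj v w ∧ S w) (axisLines v)

  spreadOnce : VSet a₁ a₂ a₃ → VSet a₁ a₂ a₃
  spreadOnce S v = S v ∨ threeDistinct (infectedNeighbours S v)

  spread* : ℕ → VSet a₁ a₂ a₃ → VSet a₁ a₂ a₃
  spread* zero    S = S
  spread* (suc t) S = spread* t (memo (spreadOnce S))

  module _ {A : VSet a₁ a₂ a₃} (perc : Percolates A) where

    stays-healthy : ∀ {t v} → ¬ T (stage t A v) → nbrsIn (stage t A) v ≤ 2 → ¬ T (stage (suc t) A v)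
    stays-healthy v∉ few v∈ with to T-∨ v∈
    ... | inj₁ v∈stage = v∉ v∈stage
    ... | inj₂ three   = <⇒≱ (s≤s few) (≤ᵇ⇒≤ 3 _ three)

    nbrsIn≤degree : ∀ B v → nbrsIn B v ≤ nbrsIn full v
    nbrsIn≤degree B v = countB-mono (λ w → from T-∧ ∘ (_, tt) ∘ proj₁ ∘ to T-∧) (vertices a₁ a₂ a₃)

    low-degree-seed : ∀ v → nbrsIn full v ≤ 2 → T (A v)
    low-degree-seed v deg≤2 with A v in v∈A
    ... | true  = tt
    ... | false = ⊥-elim (healthy (proj₁ (perc v)) (proj₂ (perc v)))
      where
      healthy : ∀ t → ¬ T (stage t A v)
      healthy zero    = subst T v∈A
      healthy (suc t) = stays-healthy {t} (healthy t) (≤-trans (nbrsIn≤degree (stage t A) v) deg≤2)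

    low-degree-edge-seed : ∀ {u w} → T (adj u w) → nbrsIn full u ≤ 3 → nbrsIn full w ≤ 3 → T (A u) ⊎ T (A w)
    low-degree-edge-seed {u} {w} u~w deg-u deg-w with A u in u∈A | A w in w∈A
    ... | true  | _     = inj₁ tt
    ... | false | true  = inj₂ tt
    ... | false | false = ⊥-elim (proj₁ (healthy (proj₁ (perc u))) (proj₂ (perc u)))
      where
      one-less : ∀ {B x y} → T (adj x y) → ¬ T (B y) → nbrsIn full x ≤ 3 → nbrsIn B x ≤ 2
      one-less {B} {x} {y} x~y y∉B deg-x = s≤s⁻¹ (≤-trans
        (countB-mono-< (λ z → from T-∧ ∘ (_, tt) ∘ proj₁ ∘ to T-∧) (∈-vertices y) (from T-∧ (x~y , tt)) (y∉B ∘ proj₂ ∘ to T-∧))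
        deg-x)
      healthy : ∀ t → ¬ T (stage t A u) × ¬ T (stage t A w)
      healthy zero    = subst T u∈A , subst T w∈A
      healthy (suc t) with healthy t
      ... | u∉ , w∉ = stays-healthy {t} u∉ (one-less u~w w∉ deg-u)
                    , stays-healthy {t} w∉ (one-less (subst T (adj-sym u w) u~w) u∉ deg-w)

-- The grid [3] × [6] × [1]

module _ (A : VSet 3 6 1) (perc : Percolates A) where

  private
    row : Fin 6 → Vertex 3 6 1
    row j = Fin.zero , j , Fin.zero

    in-row : ∀ j → nbrsIn full (row j) ≤ 2 → T (A (row j))
    in-row j = low-degree-seed perc (row j)

    edge : ∀ {u w} → T (A u) → T (A w) → T (adj u w) → 1 ≤ degreeSum A
    edge {u} {w} u∈ w∈ u~w = begin
      1                                  ≤⟨ s≤s z≤n ⟩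
      suc (countB (λ y → (adj u y ∧ A y) ∧ _≢ᵇ_ _≟ᵛ_ y w) (vertices 3 6 1))
        ≤⟨ countB-remove _≟ᵛ_ (λ y → adj u y ∧ A y) (∈-vertices w) (from T-∧ (u~w , w∈)) ⟩
      nbrsIn A u                         ≡⟨ sym (trans (cong (_* nbrsIn A u) (T⇒⟦⟧≡1 u∈)) (*-identityˡ (nbrsIn A u))) ⟩
      ⟦ A u ⟧ * nbrsIn A u                ≤⟨ term≤∑ᵛ (λ v → ⟦ A v ⟧ * nbrsIn A v) u ⟩
      degreeSum A                        ∎
      where open ≤-Reasoning

  infected-edge-3×6×1 : 1 ≤ degreeSum A
  infected-edge-3×6×1 with T? (A (row (# 1)))
  ... | yes p₁∈ = edge (in-row (# 0) ≤-refl) p₁∈ tt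
  ... | no  p₁∉ with low-degree-edge-seed perc {row (# 1)} {row (# 2)} tt ≤-refl ≤-refl
  ...   | inj₁ p₁∈ = ⊥-elim (p₁∉ p₁∈)
  ...   | inj₂ p₂∈ with T? (A (row (# 3)))
  ...     | yes p₃∈ = edge p₂∈ p₃∈ tt
  ...     | no  p₃∉ with low-degree-edge-seed perc {row (# 3)} {row (# 4)} tt ≤-refl ≤-refl
  ...       | inj₁ p₃∈ = ⊥-elim (p₃∉ p₃∈)
  ...       | inj₂ p₄∈ = edge p₄∈ (in-row (# 5) ≤-refl) tt

Cell : ℕ → ℕ → Set
Cell a₁ a₂ = Fin a₁ × Fin a₂

Layer : ℕ → ℕ → Set
Layer a₁ a₂ = Cell a₁ a₂ → Bool

module _ {a₁ a₂ : ℕ} where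

  _⊆ˡ_ : Layer a₁ a₂ → Layer a₁ a₂ → Set
  X ⊆ˡ Y = ∀ i j → T (X (i , j)) → T (Y (i , j))

  infix 4 _⊆ˡ_

  _⊆ˡ?_ : (X Y : Layer a₁ a₂) → Dec (X ⊆ˡ Y)
  X ⊆ˡ? Y = all? λ i → all? λ j → T? (X (i , j)) →-dec T? (Y (i , j))

  _∪ˡ_ : Layer a₁ a₂ → Layer a₁ a₂ → Layer a₁ a₂
  (X ∪ˡ Y) c = X c ∨ Y c

  infixr 6 _∪ˡ_

  Full : Layer a₁ a₂
  Full _ = true

  layer : ∀ {h} → VSet a₁ a₂ h → Fin h → Layer a₁ a₂
  layer S k (i , j) = S (i , j , k)

  stack : ∀ {h} → Vec (Layer a₁ a₂) h → VSet a₁ a₂ h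
  stack Ls (i , j , k) = Vec.lookup Ls k (i , j)

  -- a₁ * a₂ * h rounds always reach the closure.  The definition is opaque so that
  -- conversion checking never evaluates it; coverage facts are evaluated in `unfolding` blocks.
  opaque
    windowClosure : ∀ {h} → Vec (Layer a₁ a₂) h → Fin h → Layer a₁ a₂
    windowClosure {h} K = layer (spread* (a₁ * a₂ * h) (stack K))

module Window {a₁ a₂ n : ℕ} (A : VSet a₁ a₂ n) where

  InfectedOn : Layer a₁ a₂ → ℕ → Set
  InfectedOn X l = ∀ i j → T (X (i , j)) → (l<n : l < n) → Infected A (i , j , fromℕ< l<n)

  module _ {h : ℕ} (b : ℕ) (fits : h + b ≤ n) where

    offset<n : (k : Fin h) → toℕ k + b < n
    offset<n k = ≤-trans (+-monoˡ-< b (toℕ<n k)) fits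

    lift : Vertex a₁ a₂ h → Vertex a₁ a₂ n
    lift (i , j , k) = i , j , fromℕ< (offset<n k)

    adj-lift : ∀ v w → adj (lift v) (lift w) ≡ adj v w
    adj-lift (i , j , k) (i' , j' , k')
      rewrite toℕ-fromℕ< (offset<n k) | toℕ-fromℕ< (offset<n k')
            | ≡ᵇ-+ʳ b (toℕ k) (toℕ k') | dist1-+ʳ b (toℕ k) (toℕ k') = refl

    lift-injective : ∀ {v w} → lift v ≡ lift w → v ≡ w
    lift-injective {i , j , k} {i' , j' , k'} eq =
      cong₂ _,_ (cong proj₁ eq) (cong₂ _,_ (cong (proj₁ ∘ proj₂) eq)
        (toℕ-injective (+-cancelʳ-≡ b _ _ (fromℕ<-injective _ _ _ _ (cong (proj₂ ∘ proj₂) eq)))))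

    Sound : VSet a₁ a₂ h → Set
    Sound S = ∀ v → T (S v) → Infected A (lift v)

    spreadOnce-sound : ∀ {S} → Sound S → Sound (spreadOnce S)
    spreadOnce-sound {S} sound v v∈ with to T-∨ v∈
    ... | inj₁ v∈S   = sound v v∈S
    ... | inj₂ three = spread-from (all-filter (T? ∘ (λ w → adj v w ∧ S w)) (axisLines v)) three
      where
      infected-neighbour : ∀ {w} → T (adj v w ∧ S w) → T (adj (lift v) (lift w)) × Infected A (lift w)
      infected-neighbour {w} v~w∈S with to T-∧ v~w∈S
      ... | v~w , w∈S = subst T (sym (adj-lift v w)) v~w , sound w w∈S
      lift-≢ : ∀ {w w'} → T (_≢ᵇ_ _≟ᵛ_ w w') → lift w ≢ lift w'
      lift-≢ w≢w' = ≢ᵇ⇒≢ _≟ᵛ_ w≢w' ∘ lift-injective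
      spread-from : ∀ {ws} → All (λ w → T (adj v w ∧ S w)) ws → T (threeDistinct ws) → Infected A (lift v)
      spread-from (x ∷ y ∷ z ∷ _) distinct with to T-∧ distinct
      ... | x≢y , xz-yz with to T-∧ xz-yz
      ...   | x≢z , y≢z with infected-neighbour x | infected-neighbour y | infected-neighbour z
      ...     | v~x , inf-x | v~y , inf-y | v~z , inf-z =
        spread v~x v~y v~z (lift-≢ x≢y) (lift-≢ x≢z) (lift-≢ y≢z) inf-x inf-y inf-z

    spread*-sound : ∀ t {S} → Sound S → Sound (spread* t S)
    spread*-sound zero    sound = sound
    spread*-sound (suc t) {S} sound =
      spread*-sound t λ v v∈ → spreadOnce-sound sound v (subst T (memo-correct (spreadOnce S) v) v∈)

    opaque
      unfolding windowClosure
      window-closure-infected : (K : Vec (Layer a₁ a₂) h) → (∀ k → InfectedOn (Vec.lookup K k) (toℕ k + b)) →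
                                ∀ k (X : Layer a₁ a₂) → {_ : True (X ⊆ˡ? windowClosure K k)} →
                                InfectedOn X (toℕ k + b)
      window-closure-infected K hyps k X {covered} i j x∈X l<n =
        subst (Infected A) (cong (λ k′ → i , j , k′) (fromℕ<-cong _ _ refl (offset<n k) l<n))
          (spread*-sound (a₁ * a₂ * h) stack-sound (i , j , k) (toWitness covered i j x∈X))
        where
        stack-sound : Sound (stack K)
        stack-sound (i , j , k) v∈ = hyps k i j v∈ (offset<n k)

  InfectedOn-⊆ : ∀ {X Y l} → X ⊆ˡ Y → InfectedOn Y l → InfectedOn X l
  InfectedOn-⊆ X⊆Y Y-infected i j x∈X = Y-infected i j (X⊆Y i j x∈X)

  InfectedOn-∪ : ∀ {X Y l} → InfectedOn X l → InfectedOn Y l → InfectedOn (X ∪ˡ Y) l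
  InfectedOn-∪ X-infected Y-infected i j x∈X∪Y with to T-∨ x∈X∪Y
  ... | inj₁ x∈X = X-infected i j x∈X
  ... | inj₂ x∈Y = Y-infected i j x∈Y

  all-layers⇒percolates : (∀ l → l < n → InfectedOn Full l) → Percolates A
  all-layers⇒percolates all-full (i , j , k) = Infected⇒stage A
    (subst (λ k′ → Infected A (i , j , k′)) (fromℕ<-toℕ k (toℕ<n k)) (all-full (toℕ k) (toℕ<n k) i j tt (toℕ<n k)))

layered : ∀ {a₁ a₂ n} → (ℕ → Layer a₁ a₂) → VSet a₁ a₂ n
layered L (i , j , k) = L (toℕ k) (i , j)

module _ {a₁ a₂ n : ℕ} (L : ℕ → Layer a₁ a₂) where
  open Window (layered {n = n} L)

  InfectedOn-seeds : ∀ {X l} → X ⊆ˡ L l → InfectedOn X l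
  InfectedOn-seeds {X} {l} X⊆L i j x∈X l<n =
    seed (subst (λ l′ → T (L l′ (i , j))) (sym (toℕ-fromℕ< l<n)) (X⊆L i j x∈X))

downward-induction : ∀ {P : ℕ → Set} {lo hi} → P hi → (∀ l → lo ≤ l → l < hi → P (suc l) → P l) →
                     ∀ l → lo ≤ l → l ≤ hi → P l
downward-induction {P} {lo} {hi} P-hi step l lo≤l l≤hi = go (hi ∸ l) l lo≤l (m∸n+n≡m l≤hi)
  where
  go : ∀ d l → lo ≤ l → d + l ≡ hi → P l
  go zero    l _    refl = P-hi
  go (suc d) l lo≤l eq   = step l lo≤l (subst (l <_) eq (s≤s (m≤n+m l d)))
                                 (go d (suc l) (m≤n⇒m≤1+n lo≤l) (trans (+-suc d l) eq))

-- A cell (i , j) lies in row i < 3 and column j < 6.  P (isOdd l) is seeded on layer l;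
-- Up and Down are what the upward and the downward sweep infect on a middle layer.
cellsOf : ∀ {a₁ a₂} → List (ℕ × ℕ) → Layer a₁ a₂
cellsOf cs (i , j) = any (λ (x , y) → (toℕ i ≡ᵇ x) ∧ (toℕ j ≡ᵇ y)) cs

isOdd : ℕ → Bool
isOdd zero    = false
isOdd (suc l) = not (isOdd l)

P : Bool → Layer 3 6
P false = cellsOf ((1 , 3) ∷ (1 , 5) ∷ (2 , 4) ∷ [])
P true  = cellsOf ((0 , 1) ∷ (1 , 0) ∷ (1 , 2) ∷ [])

Eᵇ Eᵗ Xᵗ Tᵗ Up Down : Layer 3 6
Eᵇ   = cellsOf ((0 , 0) ∷ (2 , 0) ∷ (2 , 2) ∷ [])
Eᵗ   = cellsOf ((0 , 3) ∷ (0 , 5) ∷ (2 , 5) ∷ [])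
Xᵗ   = cellsOf ((0 , 4) ∷ [])
Tᵗ   = cellsOf ((0 , 2) ∷ (0 , 5) ∷ (1 , 3) ∷ (2 , 0) ∷ (2 , 5) ∷ [])
Up   = cellsOf ((0 , 0) ∷ (0 , 1) ∷ (1 , 0) ∷ (1 , 1) ∷ (1 , 2) ∷ (1 , 3) ∷ (1 , 4) ∷ (1 , 5) ∷
                (2 , 0) ∷ (2 , 1) ∷ (2 , 2) ∷ (2 , 3) ∷ (2 , 4) ∷ [])
Down = cellsOf ((0 , 1) ∷ (0 , 2) ∷ (0 , 3) ∷ (0 , 4) ∷ (0 , 5) ∷ (1 , 0) ∷ (1 , 1) ∷ (1 , 2) ∷
                (1 , 3) ∷ (1 , 4) ∷ (1 , 5) ∷ (2 , 4) ∷ (2 , 5) ∷ [])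

module Steps {n : ℕ} (A : VSet 3 6 n) where
  open Window A

  private
    opaque
      unfolding windowClosure

      up-base-covered : True (Up ⊆ˡ? windowClosure (P false ∪ˡ Eᵇ ∷ P true ∷ []) (# 0))
      up-base-covered = _

      up-covered : ∀ c → True (Up ⊆ˡ? windowClosure (Up ∷ P c ∷ P (not c) ∷ []) (# 1))
      up-covered false = _
      up-covered true  = _

      down-covered : ∀ c → True (Down ⊆ˡ? windowClosure (P c ∷ P (not c) ∷ Down ∷ []) (# 1))
      down-covered false = _
      down-covered true  = _

      bottom-covered : True (Full ⊆ˡ? windowClosure (Up ∪ˡ P false ∪ˡ Eᵇ ∷ Down ∪ˡ P true ∷ []) (# 0))
      bottom-covered = _

      even-top-covered : True (Full ⊆ˡ? windowClosure (Up ∪ˡ P false ∷ P true ∪ˡ Eᵗ ∷ []) (# 1))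
      even-top-covered = _

      odd-top-covered₁ : True (Full ⊆ˡ? windowClosure (Up ∪ˡ P false ∷ P true ∪ˡ Xᵗ ∷ Tᵗ ∷ []) (# 1))
      odd-top-covered₁ = _

      odd-top-covered₂ : True (Full ⊆ˡ? windowClosure (Up ∪ˡ P false ∷ P true ∪ˡ Xᵗ ∷ Tᵗ ∷ []) (# 2))
      odd-top-covered₂ = _

  up-base : 2 ≤ n → InfectedOn (P false ∪ˡ Eᵇ) 0 → InfectedOn (P true) 1 → InfectedOn Up 0
  up-base fits h₀ h₁ =
    window-closure-infected 0 (subst (_≤ n) (sym (+-identityʳ 2)) fits) (P false ∪ˡ Eᵇ ∷ P true ∷ [])
      (λ { Fin.zero → h₀ ; (Fin.suc Fin.zero) → h₁ }) (# 0) Up {up-base-covered}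

  up-step : ∀ c b → 3 + b ≤ n → InfectedOn Up b → InfectedOn (P c) (1 + b) → InfectedOn (P (not c)) (2 + b) →
            InfectedOn Up (1 + b)
  up-step c b fits h₀ h₁ h₂ = window-closure-infected b fits (Up ∷ P c ∷ P (not c) ∷ [])
    (λ { Fin.zero → h₀ ; (Fin.suc Fin.zero) → h₁ ; (Fin.suc (Fin.suc Fin.zero)) → h₂ }) (# 1) Up {up-covered c}

  down-step : ∀ c b → 3 + b ≤ n → InfectedOn (P c) b → InfectedOn (P (not c)) (1 + b) → InfectedOn Down (2 + b) →
              InfectedOn Down (1 + b)
  down-step c b fits h₀ h₁ h₂ = window-closure-infected b fits (P c ∷ P (not c) ∷ Down ∷ [])
    (λ { Fin.zero → h₀ ; (Fin.suc Fin.zero) → h₁ ; (Fin.suc (Fin.suc Fin.zero)) → h₂ }) (# 1) Down {down-covered c}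

  bottom-fill : 2 ≤ n → InfectedOn (Up ∪ˡ P false ∪ˡ Eᵇ) 0 → InfectedOn (Down ∪ˡ P true) 1 → InfectedOn Full 0
  bottom-fill fits h₀ h₁ =
    window-closure-infected 0 (subst (_≤ n) (sym (+-identityʳ 2)) fits) (Up ∪ˡ P false ∪ˡ Eᵇ ∷ Down ∪ˡ P true ∷ [])
      (λ { Fin.zero → h₀ ; (Fin.suc Fin.zero) → h₁ }) (# 0) Full {bottom-covered}

  even-top : ∀ b → 2 + b ≤ n → InfectedOn (Up ∪ˡ P false) b → InfectedOn (P true ∪ˡ Eᵗ) (1 + b) →
             InfectedOn Full (1 + b)
  even-top b fits h₀ h₁ = window-closure-infected b fits (Up ∪ˡ P false ∷ P true ∪ˡ Eᵗ ∷ [])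
    (λ { Fin.zero → h₀ ; (Fin.suc Fin.zero) → h₁ }) (# 1) Full {even-top-covered}

  odd-top : ∀ b → 3 + b ≤ n → InfectedOn (Up ∪ˡ P false) b → InfectedOn (P true ∪ˡ Xᵗ) (1 + b) →
            InfectedOn Tᵗ (2 + b) → InfectedOn Full (1 + b) × InfectedOn Full (2 + b)
  odd-top b fits h₀ h₁ h₂ = window-closure-infected b fits K hyps (# 1) Full {odd-top-covered₁}
                          , window-closure-infected b fits K hyps (# 2) Full {odd-top-covered₂}
    where
    K : Vec (Layer 3 6) 3
    K = Up ∪ˡ P false ∷ P true ∪ˡ Xᵗ ∷ Tᵗ ∷ []
    hyps : ∀ k → InfectedOn (Vec.lookup K k) (toℕ k + b)
    hyps Fin.zero                     = h₀
    hyps (Fin.suc Fin.zero)           = h₁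
    hyps (Fin.suc (Fin.suc Fin.zero)) = h₂

  middle-fill : ∀ {l} → InfectedOn Up l → InfectedOn Down l → InfectedOn Full l
  middle-fill hᵤ h_d = InfectedOn-⊆ (toWitness {a? = Full ⊆ˡ? (Up ∪ˡ Down)} tt) (InfectedOn-∪ hᵤ h_d)

module Sweep {n : ℕ} (A : VSet 3 6 n) (m : ℕ) (fits : 2 + m ≤ n) where
  open Window A
  open Steps A

  module _ (pattern-seeds : ∀ l → l ≤ suc m → InfectedOn (P (isOdd l)) l)
           (bottom-seeds : InfectedOn Eᵇ 0)
           (top : InfectedOn Up m → ∀ l → suc m ≤ l → l < n → InfectedOn Full l) where

    private
      2≤n : 2 ≤ n
      2≤n = ≤-trans (m≤m+n 2 m) fits

    up : ∀ l → l ≤ m → InfectedOn Up l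
    up zero    _   = up-base 2≤n (InfectedOn-∪ (pattern-seeds 0 z≤n) bottom-seeds)
                       (pattern-seeds 1 (s≤s z≤n))
    up (suc l) l<m = up-step (isOdd (suc l)) l (≤-trans (s≤s (s≤s l<m)) fits) (up l (<⇒≤ l<m))
                       (pattern-seeds (suc l) (m≤n⇒m≤1+n l<m)) (pattern-seeds (2 + l) (s≤s l<m))

    down : ∀ l → 1 ≤ l → l ≤ suc m → InfectedOn Down l
    down = downward-induction (InfectedOn-⊆ (λ _ _ _ → tt) (top (up m ≤-refl) (suc m) ≤-refl fits))
                              down-from-above
      where
      down-from-above : ∀ l → 1 ≤ l → l < suc m → InfectedOn Down (suc l) → InfectedOn Down l
      down-from-above (suc b) _ b<m h =
        down-step (isOdd b) b (≤-trans (s≤s b<m) fits)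
          (pattern-seeds b (≤-trans (n≤1+n b) (<⇒≤ b<m))) (pattern-seeds (suc b) (<⇒≤ b<m)) h

    percolates : Percolates A
    percolates = all-layers⇒percolates layers
      where
      layers : ∀ l → l < n → InfectedOn Full l
      layers zero    _   =
        bottom-fill 2≤n (InfectedOn-∪ (up 0 z≤n) (InfectedOn-∪ (pattern-seeds 0 z≤n) bottom-seeds))
          (InfectedOn-∪ (down 1 ≤-refl (s≤s z≤n)) (pattern-seeds 1 (s≤s z≤n)))
      layers (suc l) l<n with suc l ≤? m
      ... | yes l<m = middle-fill (up (suc l) l<m) (down (suc l) (s≤s z≤n) (m≤n⇒m≤1+n l<m))
      ... | no  l≮m = top (up m ≤-refl) (suc l) (≰⇒> l≮m) l<n

module _ {a₁ a₂ : ℕ} where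

  ‖_‖ : Layer a₁ a₂ → ℕ
  ‖ X ‖ = ∑[ i < a₁ ] ∑[ j < a₂ ] ⟦ X (i , j) ⟧

  _when_ : Layer a₁ a₂ → Bool → Layer a₁ a₂
  (X when b) c = b ∧ X c

  infix 7 _when_

  ‖∪‖ : ∀ X Y → ‖ X ∪ˡ Y ‖ ≤ ‖ X ‖ + ‖ Y ‖
  ‖∪‖ X Y = ≤-trans (∑-mono {a₁} λ i → ≤-trans (∑-mono {a₂} λ j → ⟦⟧-∨≤ (X (i , j)) (Y (i , j)))
                                               (≤-reflexive (∑-distrib-+ (λ j → ⟦ X (i , j) ⟧) (λ j → ⟦ Y (i , j) ⟧))))
                    (≤-reflexive (∑-distrib-+ (λ i → ∑[ j < a₂ ] ⟦ X (i , j) ⟧) (λ i → ∑[ j < a₂ ] ⟦ Y (i , j) ⟧)))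

  ‖when‖ : ∀ X b → ‖ X when b ‖ ≡ ⟦ b ⟧ * ‖ X ‖
  ‖when‖ X b = sym (trans (*-distribˡ-sum ⟦ b ⟧ (λ i → ∑[ j < a₂ ] ⟦ X (i , j) ⟧)) (sum-cong-≗ {a₁} λ i →
                trans (*-distribˡ-sum ⟦ b ⟧ (λ j → ⟦ X (i , j) ⟧)) (sum-cong-≗ {a₂} λ j → sym (⟦⟧-∧ b (X (i , j))))))

  size-layered : ∀ {n} (L : ℕ → Layer a₁ a₂) → size (layered {n = n} L) ≡ ∑[ k < n ] ‖ L (toℕ k) ‖
  size-layered {n} L = trans (size≡∑ᵛ (layered L)) (trans
    (sum-cong-≗ {a₁} λ i → ∑-comm {a₂} {n} λ j k → ⟦ L (toℕ k) (i , j) ⟧)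
    (∑-comm {a₁} {n} λ i k → ∑[ j < a₂ ] ⟦ L (toℕ k) (i , j) ⟧))

  size-layered-≤ : ∀ {n} (L : ℕ → Layer a₁ a₂) c (f : ℕ → ℕ) → (∀ l → ‖ L l ‖ ≤ c + f l) →
                   size (layered {n = n} L) ≤ n * c + ∑[ k < n ] f (toℕ k)
  size-layered-≤ {n} L c f bound = begin
    size (layered L)                         ≡⟨ size-layered L ⟩
    ∑[ k < n ] ‖ L (toℕ k) ‖                  ≤⟨ ∑-mono {n} (bound ∘ toℕ) ⟩
    ∑[ k < n ] (c + f (toℕ k))                ≡⟨ ∑-distrib-+ {n} (λ _ → c) (f ∘ toℕ) ⟩
    ∑[ k < n ] c + ∑[ k < n ] f (toℕ k)        ≡⟨ cong (_+ ∑[ k < n ] f (toℕ k)) (∑-const n c) ⟩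
    n * c + ∑[ k < n ] f (toℕ k)              ∎
    where open ≤-Reasoning

∑-indicator-*≤ : ∀ n l e → ∑[ k < n ] (⟦ toℕ k ≡ᵇ l ⟧ * e) ≤ e
∑-indicator-*≤ n l e = begin
  ∑[ k < n ] (⟦ toℕ k ≡ᵇ l ⟧ * e)   ≡⟨ sym (*-distribʳ-sum {n} e (λ k → ⟦ toℕ k ≡ᵇ l ⟧)) ⟩
  (∑[ k < n ] ⟦ toℕ k ≡ᵇ l ⟧) * e   ≡⟨ cong (_* e) (∑-indicator n l) ⟩
  ⟦ l <ᵇ n ⟧ * e                   ≤⟨ *-monoˡ-≤ e (⟦⟧≤1 (l <ᵇ n)) ⟩
  1 * e                            ≡⟨ *-identityˡ e ⟩
  e                                ∎
  where open ≤-Reasoning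

‖P‖ : ∀ c → ‖ P c ‖ ≡ 3
‖P‖ false = refl
‖P‖ true  = refl

-- Percolating sets of size 6 + 3n in [3] × [6] × [n]

evenLayer : ℕ → ℕ → Layer 3 6
evenLayer m l = P (isOdd l) ∪ˡ Eᵇ when (l ≡ᵇ 0) ∪ˡ Eᵗ when (l ≡ᵇ suc m)

oddLayer : ℕ → ℕ → Layer 3 6
oddLayer m l = P (isOdd l) when not (l ≡ᵇ 2 + m) ∪ˡ Eᵇ when (l ≡ᵇ 0) ∪ˡ Xᵗ when (l ≡ᵇ suc m) ∪ˡ Tᵗ when (l ≡ᵇ 2 + m)

module _ (m : ℕ) where

  evenLayer-P : ∀ l → P (isOdd l) ⊆ˡ evenLayer m l
  evenLayer-P l i j = T-∨ˡ

  evenLayer-Eᵇ : Eᵇ ⊆ˡ evenLayer m 0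
  evenLayer-Eᵇ i j = T-∨ʳ (P false (i , j)) ∘ T-∨ˡ

  evenLayer-Eᵗ : Eᵗ ⊆ˡ evenLayer m (suc m)
  evenLayer-Eᵗ i j x = T-∨ʳ (P (isOdd (suc m)) (i , j)) (T-∨ʳ false (from T-∧ (≡⇒≡ᵇ m m refl , x)))

  oddLayer-P : ∀ l → l ≤ suc m → P (isOdd l) ⊆ˡ oddLayer m l
  oddLayer-P l l≤m i j x = T-∨ˡ (from T-∧ (≢⇒not-≡ᵇ (<⇒≢ (s≤s l≤m)) , x))

  oddLayer-Eᵇ : Eᵇ ⊆ˡ oddLayer m 0
  oddLayer-Eᵇ i j = T-∨ʳ (P false (i , j)) ∘ T-∨ˡ

  oddLayer-Xᵗ : Xᵗ ⊆ˡ oddLayer m (suc m)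
  oddLayer-Xᵗ i j x = T-∨ʳ (not (m ≡ᵇ suc m) ∧ P (isOdd (suc m)) (i , j))
                        (T-∨ʳ false (T-∨ˡ (from T-∧ (≡⇒≡ᵇ m m refl , x))))

  oddLayer-Tᵗ : Tᵗ ⊆ˡ oddLayer m (2 + m)
  oddLayer-Tᵗ i j x = T-∨ʳ (not (m ≡ᵇ m) ∧ P (isOdd (2 + m)) (i , j))
                        (T-∨ʳ false (T-∨ʳ ((suc m ≡ᵇ m) ∧ Xᵗ (i , j)) (from T-∧ (≡⇒≡ᵇ m m refl , x))))

module _ (m : ℕ) (m-even : isOdd m ≡ false) where

  even-percolates : Percolates (layered {n = 2 + m} (evenLayer m))
  even-percolates = Sweep.percolates A m ≤-refl pattern-seeds (InfectedOn-seeds L (evenLayer-Eᵇ m)) top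
    where
    L = evenLayer m
    A = layered {n = 2 + m} L
    open Window A
    open Steps A
    pattern-seeds : ∀ l → l ≤ suc m → InfectedOn (P (isOdd l)) l
    pattern-seeds l _ = InfectedOn-seeds L (evenLayer-P m l)
    pattern-at-m : InfectedOn (P false) m
    pattern-at-m = subst (λ c → InfectedOn (P c) m) m-even (pattern-seeds m (n≤1+n m))
    pattern-at-1+m : InfectedOn (P true) (suc m)
    pattern-at-1+m = subst (λ c → InfectedOn (P c) (suc m)) (cong not m-even) (pattern-seeds (suc m) ≤-refl)
    top : InfectedOn Up m → ∀ l → suc m ≤ l → l < 2 + m → InfectedOn Full l
    top hᵤ l m<l l<n = subst (InfectedOn Full) (≤-antisym m<l (s≤s⁻¹ l<n))
      (even-top m ≤-refl (InfectedOn-∪ hᵤ pattern-at-m) (InfectedOn-∪ pattern-at-1+m (InfectedOn-seeds L (evenLayer-Eᵗ m))))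

  odd-percolates : Percolates (layered {n = 3 + m} (oddLayer m))
  odd-percolates = Sweep.percolates A m (n≤1+n _) pattern-seeds (InfectedOn-seeds L (oddLayer-Eᵇ m)) top
    where
    L = oddLayer m
    A = layered {n = 3 + m} L
    open Window A
    open Steps A
    pattern-seeds : ∀ l → l ≤ suc m → InfectedOn (P (isOdd l)) l
    pattern-seeds l l≤m = InfectedOn-seeds L (oddLayer-P m l l≤m)
    pattern-at-m : InfectedOn (P false) m
    pattern-at-m = subst (λ c → InfectedOn (P c) m) m-even (pattern-seeds m (n≤1+n m))
    pattern-at-1+m : InfectedOn (P true) (suc m)
    pattern-at-1+m = subst (λ c → InfectedOn (P c) (suc m)) (cong not m-even) (pattern-seeds (suc m) ≤-refl)
    top-layers : InfectedOn Up m → InfectedOn Full (1 + m) × InfectedOn Full (2 + m)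
    top-layers hᵤ = odd-top m ≤-refl (InfectedOn-∪ hᵤ pattern-at-m)
      (InfectedOn-∪ pattern-at-1+m (InfectedOn-seeds L (oddLayer-Xᵗ m))) (InfectedOn-seeds L (oddLayer-Tᵗ m))
    top : InfectedOn Up m → ∀ l → suc m ≤ l → l < 3 + m → InfectedOn Full l
    top hᵤ l m<l l<n with l ≤? suc m
    ... | yes l≤m = subst (InfectedOn Full) (≤-antisym m<l l≤m) (proj₁ (top-layers hᵤ))
    ... | no  l≰m = subst (InfectedOn Full) (≤-antisym (≰⇒> l≰m) (s≤s⁻¹ l<n)) (proj₂ (top-layers hᵤ))

module _ (m : ℕ) where

  ‖evenLayer‖ : ∀ l → ‖ evenLayer m l ‖ ≤ 3 + (⟦ l ≡ᵇ 0 ⟧ * 3 + ⟦ l ≡ᵇ suc m ⟧ * 3)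
  ‖evenLayer‖ l = begin
    ‖ evenLayer m l ‖
      ≤⟨ ≤-trans (‖∪‖ (P (isOdd l)) (Eᵇ when (l ≡ᵇ 0) ∪ˡ Eᵗ when (l ≡ᵇ suc m)))
                 (+-monoʳ-≤ ‖ P (isOdd l) ‖ (‖∪‖ (Eᵇ when (l ≡ᵇ 0)) (Eᵗ when (l ≡ᵇ suc m)))) ⟩
    ‖ P (isOdd l) ‖ + (‖ Eᵇ when (l ≡ᵇ 0) ‖ + ‖ Eᵗ when (l ≡ᵇ suc m) ‖)
      ≡⟨ cong₂ _+_ (‖P‖ (isOdd l)) (cong₂ _+_ (‖when‖ Eᵇ (l ≡ᵇ 0)) (‖when‖ Eᵗ (l ≡ᵇ suc m))) ⟩
    3 + (⟦ l ≡ᵇ 0 ⟧ * 3 + ⟦ l ≡ᵇ suc m ⟧ * 3) ∎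
    where open ≤-Reasoning

  ‖oddLayer‖ : ∀ l → ‖ oddLayer m l ‖ ≤ 3 + (⟦ l ≡ᵇ 0 ⟧ * 3 + (⟦ l ≡ᵇ suc m ⟧ * 1 + ⟦ l ≡ᵇ 2 + m ⟧ * 2))
  ‖oddLayer‖ l = begin
    ‖ oddLayer m l ‖
      ≤⟨ ≤-trans (‖∪‖ (P (isOdd l) when not top) (Eᵇ when (l ≡ᵇ 0) ∪ˡ Xᵗ when (l ≡ᵇ suc m) ∪ˡ Tᵗ when top))
          (+-monoʳ-≤ ‖ P (isOdd l) when not top ‖ (≤-trans (‖∪‖ (Eᵇ when (l ≡ᵇ 0)) (Xᵗ when (l ≡ᵇ suc m) ∪ˡ Tᵗ when top))
          (+-monoʳ-≤ ‖ Eᵇ when (l ≡ᵇ 0) ‖ (‖∪‖ (Xᵗ when (l ≡ᵇ suc m)) (Tᵗ when top))))) ⟩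
    ‖ P (isOdd l) when not top ‖ + (‖ Eᵇ when (l ≡ᵇ 0) ‖ + (‖ Xᵗ when (l ≡ᵇ suc m) ‖ + ‖ Tᵗ when top ‖))
      ≡⟨ cong₂ _+_ (trans (‖when‖ (P (isOdd l)) (not top)) (cong (⟦ not top ⟧ *_) (‖P‖ (isOdd l))))
                   (cong₂ _+_ (‖when‖ Eᵇ (l ≡ᵇ 0)) (cong₂ _+_ (‖when‖ Xᵗ (l ≡ᵇ suc m)) (‖when‖ Tᵗ top))) ⟩
    ⟦ not top ⟧ * 3 + (⟦ l ≡ᵇ 0 ⟧ * 3 + (⟦ l ≡ᵇ suc m ⟧ * 1 + ⟦ top ⟧ * 5))
      ≤⟨ replace-pattern top (⟦ l ≡ᵇ 0 ⟧ * 3) (⟦ l ≡ᵇ suc m ⟧ * 1) ⟩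
    3 + (⟦ l ≡ᵇ 0 ⟧ * 3 + (⟦ l ≡ᵇ suc m ⟧ * 1 + ⟦ top ⟧ * 2)) ∎
    where
    open ≤-Reasoning
    top = l ≡ᵇ 2 + m
    replace-pattern : ∀ t x y → ⟦ not t ⟧ * 3 + (x + (y + ⟦ t ⟧ * 5)) ≤ 3 + (x + (y + ⟦ t ⟧ * 2))
    replace-pattern false x y = ≤-refl
    replace-pattern true  x y = ≤-reflexive (shift x y)
      where
      shift : ∀ x y → x + (y + 5) ≡ 3 + (x + (y + 2))
      shift = solve-∀

  even-size : size (layered {n = 2 + m} (evenLayer m)) ≤ (2 + m) * 3 + 6
  even-size = ≤-trans (size-layered-≤ {n = 2 + m} (evenLayer m) 3 extras ‖evenLayer‖) (+-monoʳ-≤ ((2 + m) * 3) (begin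
    ∑[ k < 2 + m ] extras (toℕ k)
      ≡⟨ ∑-distrib-+ {2 + m} (λ k → ⟦ toℕ k ≡ᵇ 0 ⟧ * 3) (λ k → ⟦ toℕ k ≡ᵇ suc m ⟧ * 3) ⟩
    ∑[ k < 2 + m ] (⟦ toℕ k ≡ᵇ 0 ⟧ * 3) + ∑[ k < 2 + m ] (⟦ toℕ k ≡ᵇ suc m ⟧ * 3)
      ≤⟨ +-mono-≤ (∑-indicator-*≤ (2 + m) 0 3) (∑-indicator-*≤ (2 + m) (suc m) 3) ⟩
    6 ∎))
    where
    open ≤-Reasoning
    extras : ℕ → ℕ
    extras l = ⟦ l ≡ᵇ 0 ⟧ * 3 + ⟦ l ≡ᵇ suc m ⟧ * 3

  odd-size : size (layered {n = 3 + m} (oddLayer m)) ≤ (3 + m) * 3 + 6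
  odd-size = ≤-trans (size-layered-≤ {n = 3 + m} (oddLayer m) 3 extras ‖oddLayer‖) (+-monoʳ-≤ ((3 + m) * 3) (begin
    ∑[ k < 3 + m ] extras (toℕ k)
      ≡⟨ trans (∑-distrib-+ {3 + m} (λ k → ⟦ toℕ k ≡ᵇ 0 ⟧ * 3) (λ k → ⟦ toℕ k ≡ᵇ suc m ⟧ * 1 + ⟦ toℕ k ≡ᵇ 2 + m ⟧ * 2))
               (cong (∑[ k < 3 + m ] (⟦ toℕ k ≡ᵇ 0 ⟧ * 3) +_)
                     (∑-distrib-+ {3 + m} (λ k → ⟦ toℕ k ≡ᵇ suc m ⟧ * 1) (λ k → ⟦ toℕ k ≡ᵇ 2 + m ⟧ * 2))) ⟩
    ∑[ k < 3 + m ] (⟦ toℕ k ≡ᵇ 0 ⟧ * 3)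
      + (∑[ k < 3 + m ] (⟦ toℕ k ≡ᵇ suc m ⟧ * 1) + ∑[ k < 3 + m ] (⟦ toℕ k ≡ᵇ 2 + m ⟧ * 2))
      ≤⟨ +-mono-≤ (∑-indicator-*≤ (3 + m) 0 3)
                  (+-mono-≤ (∑-indicator-*≤ (3 + m) (suc m) 1) (∑-indicator-*≤ (3 + m) (2 + m) 2)) ⟩
    6 ∎))
    where
    open ≤-Reasoning
    extras : ℕ → ℕ
    extras l = ⟦ l ≡ᵇ 0 ⟧ * 3 + (⟦ l ≡ᵇ suc m ⟧ * 1 + ⟦ l ≡ᵇ 2 + m ⟧ * 2)

perfect-if-attained : ∀ {a₁ a₂ a₃} .{{_ : NonZero a₁}} .{{_ : NonZero a₂}} .{{_ : NonZero a₃}} →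
                      3 ∣ surface a₁ a₂ a₃ → (A : VSet a₁ a₂ a₃) → Percolates A →
                      3 * size A ≤ surface a₁ a₂ a₃ → Perfect a₁ a₂ a₃
perfect-if-attained {a₁ = a₁} {a₂ = a₂} {a₃ = a₃} 3∣S@(divides q S≡q*3) A perc 3|A|≤S =
  3∣S , subst (IsMinPercolatingSize a₁ a₂ a₃) (sym S/3≡q) ((A , perc , ≤-antisym |A|≤q (q≤ A perc)) , q≤)
  where
  S = surface a₁ a₂ a₃
  S/3≡q : S / 3 ≡ q
  S/3≡q = trans (cong (_/ 3) S≡q*3) (m*n/n≡m q 3)
  q≤ : ∀ (B : VSet a₁ a₂ a₃) → Percolates B → q ≤ size B
  q≤ B perc-B = *-cancelʳ-≤ q (size B) 3 (begin
    q * 3          ≡⟨ sym S≡q*3 ⟩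
    S              ≤⟨ *-cancelˡ-≤ 2 2S≤2*3|B| ⟩
    3 * size B     ≡⟨ *-comm 3 (size B) ⟩
    size B * 3     ∎)
    where
    open ≤-Reasoning
    2S≤2*3|B| : 2 * S ≤ 2 * (3 * size B)
    2S≤2*3|B| = ≤-trans (m≤m+n (2 * S) (degreeSum B))
                  (≤-trans (perimeter-bound B perc-B) (≤-reflexive (*-assoc 2 3 (size B))))
  |A|≤q : size A ≤ q
  |A|≤q = *-cancelʳ-≤ (size A) q 3
            (≤-trans (≤-reflexive (*-comm (size A) 3)) (≤-trans 3|A|≤S (≤-reflexive S≡q*3)))

¬perfect-3×6×1 : ¬ Perfect 3 6 1
¬perfect-3×6×1 (_ , (A , perc , |A|≡9) , _) = <-irrefl refl (begin-strict
  54             <⟨ +-monoʳ-< 54 (infected-edge-3×6×1 A perc) ⟩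
  54 + degreeSum A ≤⟨ perimeter-bound A perc ⟩
  6 * size A     ≡⟨ cong (6 *_) |A|≡9 ⟩
  54             ∎)
  where open ≤-Reasoning

module _ (n : ℕ) where

  surface-3×6 : surface 3 6 n ≡ 3 * (n * 3 + 6)
  surface-3×6 = solve-∀′ n
    where
    solve-∀′ : ∀ n → 3 * 6 + 3 * n + 6 * n ≡ 3 * (n * 3 + 6)
    solve-∀′ = solve-∀

  perfect-3×6-if : (A : VSet 3 6 n) → .{{NonZero n}} → Percolates A → size A ≤ n * 3 + 6 → Perfect 3 6 n
  perfect-3×6-if A perc |A|≤ = perfect-if-attained (divides (n * 3 + 6) (trans surface-3×6 (*-comm 3 (n * 3 + 6)))) A perc
    (≤-trans (*-monoʳ-≤ 3 |A|≤) (≤-reflexive (sym surface-3×6)))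

perfect-3×6 : ∀ m → Perfect 3 6 (2 + m)
perfect-3×6 zero = perfect-3×6-if 2 _ (even-percolates 0 refl) (even-size 0)
perfect-3×6 (suc m) with isOdd m in parity
... | false = perfect-3×6-if (3 + m) _ (odd-percolates m parity) (odd-size m)
... | true  = perfect-3×6-if (3 + m) _ (even-percolates (suc m) (cong not parity)) (even-size (suc m))

corollary5p12 : (a₃ : ℕ) → 1 ≤ a₃ → (Perfect 3 6 a₃ ⇔ 2 ≤ a₃)
corollary5p12 (suc zero)    _ = mk⇔ (⊥-elim ∘ ¬perfect-3×6×1) λ { (s≤s ()) }
corollary5p12 (suc (suc m)) _ = mk⇔ (λ _ → s≤s (s≤s z≤n)) (λ _ → perfect-3×6 m)
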